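{- Let $n\ge 2$, and in $\mathfrak{e}_{C_n}$ let $I'$ be the linear span of $S=\{u_{i,j}:1\le i<j\le n\}\setminus\{[e_1[e_1e_2]]\}$, where $u_{i,j}=[e_i[e_{i-1}[\cdots[e_2[e_1[e_1[e_2[\cdots[e_{j-1}e_j]\cdots]$. Then $I'$ is abelian: $[I',I']=0$.
   Context: All Lie algebras are over $\mathbb{C}$. The electrical Lie algebra $\mathfrak{e}_{C_n}$ is generated by $e_1,\dots,e_n$ subject to: $[e_i,e_j]=0$ if $|i-j|\ge 2$; $[e_i,[e_i,e_j]]=-2e_i$ if $|i-j|=1$ and $i\ne 1$; and $[e_1,[e_1,[e_1,e_2]]]=0$. The element $u_{i,j}$ ($1\le i<j\le n$) is the right-nested bracket of the sequence $e_i,e_{i-1},\dots,e_2,e_1,e_1,e_2,\dots,e_{j-1},e_j$. -}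

module Defs where

open import Level using (Level; _⊔_; suc)
open import Data.Nat using (ℕ; zero) renaming (suc to 1+)
open import Data.List using (List; []; _∷_; _++_)
open import Data.Product using (Σ; ∃; _×_; _,_)
open import Relation.Nullary using (¬_)
open import Data.Nat using (_≤_; _<_) renaming (_+_ to _+ℕ_)
open import Data.Sum using (_⊎_)
open import Relation.Binary.PropositionalEquality using (_≡_)
open import Level using (Lift)
open import Algebra.Bundles using (CommutativeRing)
open import Algebra.Module.Bundles using (Module)

module _ {c ℓ : Level} (K : CommutativeRing c ℓ) where
  open CommutativeRing K

  natK : ℕ → Carrier
  natK zero = 0#
  natK (1+ k) = 1# + natK k

  record IsCharZeroField : Set (c ⊔ ℓ) where
    field
      nontrivial : ¬ (1# ≈ 0#)
      inverse    : ∀ x → ¬ (x ≈ 0#) → ∃ λ y → x * y ≈ 1#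
      charZero   : ∀ k → ¬ (natK (1+ k) ≈ 0#)

record LieAlgebra {c ℓ : Level} (K : CommutativeRing c ℓ) (m ℓm : Level)
       : Set (c ⊔ ℓ ⊔ suc (m ⊔ ℓm)) where
  open CommutativeRing K using (Carrier)
  field
    module′ : Module K m ℓm
  open Module module′ public
  field
    [_,_]       : Carrierᴹ → Carrierᴹ → Carrierᴹ
    bracket-cong : ∀ {x x′ y y′} → x ≈ᴹ x′ → y ≈ᴹ y′ → [ x , y ] ≈ᴹ [ x′ , y′ ]
    bracket-+ˡ  : ∀ x y z → [ x +ᴹ y , z ] ≈ᴹ ([ x , z ] +ᴹ [ y , z ])
    bracket-+ʳ  : ∀ x y z → [ x , y +ᴹ z ] ≈ᴹ ([ x , y ] +ᴹ [ x , z ])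
    bracket-*ˡ  : ∀ (a : Carrier) x y → [ a *ₗ x , y ] ≈ᴹ (a *ₗ [ x , y ])
    bracket-*ʳ  : ∀ (a : Carrier) x y → [ x , a *ₗ y ] ≈ᴹ (a *ₗ [ x , y ])
    alternating : ∀ x → [ x , x ] ≈ᴹ 0ᴹ
    jacobi      : ∀ x y z →
                  (([ x , [ y , z ] ] +ᴹ [ y , [ z , x ] ]) +ᴹ [ z , [ x , y ] ]) ≈ᴹ 0ᴹ

module _ {c ℓ m ℓm : Level} {K : CommutativeRing c ℓ} (L : LieAlgebra K m ℓm) where
  open CommutativeRing K using (Carrier; 1#; -_; _+_)
  open LieAlgebra L

  -- The defining relations of the electrical Lie algebra e_{C_n}, for a
  -- family e : ℕ → L (only e 1, ..., e n matter).
  record ElectricalCRelations (n : ℕ) (e : ℕ → Carrierᴹ) : Set (ℓm) where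
    field
      far  : ∀ i j → 1 ≤ i → i ≤ n → 1 ≤ j → j ≤ n →
             (2 +ℕ i ≤ j) ⊎ (2 +ℕ j ≤ i) → [ e i , e j ] ≈ᴹ 0ᴹ
      near : ∀ i j → 1 ≤ i → i ≤ n → 1 ≤ j → j ≤ n →
             (1+ i ≡ j) ⊎ (1+ j ≡ i) → ¬ (i ≡ 1) →
             [ e i , [ e i , e j ] ] ≈ᴹ (- (1# + 1#)) *ₗ e i
      end  : [ e 1 , [ e 1 , [ e 1 , e 2 ] ] ] ≈ᴹ 0ᴹ

  nest : (ℕ → Carrierᴹ) → ℕ → List ℕ → Carrierᴹ
  nest e k [] = e k
  nest e k (k′ ∷ ks) = [ e k , nest e k′ ks ]

  up : ℕ → List ℕ
  up zero = []
  up (1+ j) = up j ++ (1+ j ∷ [])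

  down : ℕ → List ℕ
  down zero = []
  down (1+ i) = 1+ i ∷ down i

  -- u_{i,j} = [e_i [e_{i-1} [ ... [e_1 [e_1 [e_2 [ ... [e_{j-1} e_j] ... ]
  -- (for i ≥ 1, the sequence down i ++ up j starts with i)
  u : (ℕ → Carrierᴹ) → ℕ → ℕ → Carrierᴹ
  u e i j with down i ++ up j
  ... | [] = 0ᴹ            -- never used: i ≥ 1 in all uses
  ... | k ∷ ks = nest e k ks

  data Span (P : Carrierᴹ → Set (m ⊔ ℓm)) : Carrierᴹ → Set (c ⊔ m ⊔ ℓm) where
    gen  : ∀ {x} → P x → Span P x
    zero : Span P 0ᴹ
    add  : ∀ {x y} → Span P x → Span P y → Span P (x +ᴹ y)
    smul : ∀ (a : Carrier) {x} → Span P x → Span P (a *ₗ x)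
    resp : ∀ {x y} → x ≈ᴹ y → Span P x → Span P y

  -- S = { u_{i,j} : 1 ≤ i < j ≤ n } minus [e_1 [e_1 e_2]] = u_{1,2}
  InS : ℕ → (ℕ → Carrierᴹ) → Carrierᴹ → Set (m ⊔ ℓm)
  InS n e x = Σ ℕ λ i → Σ ℕ λ j →
    (1 ≤ i) × (i < j) × (j ≤ n) × ¬ ((i ≡ 1) × (j ≡ 2)) × Lift m (x ≈ᴹ u e i j)

-- Replace the excluded u₁₂ by N = u₁₂ + 2e₁, which still satisfies [e₃,N] = -u₁₃ but commutes with
-- e₂, and prove by induction on m that N and the u_{i,j} with j ≤ m pairwise commute.  Every new
-- generator u_{i,m+1} is [u_{i,m}, e_{m+1}] (or [e_m, u_{m-1,m+1}] on the diagonal), so the Jacobi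
-- identity reduces its brackets to brackets of old generators and to the action of a single e_a on
-- some u_{i,j}.  That action is computed from the defining relations: e_a kills u_{i,j} once
-- a ≥ j + 2, and e_{j+1}, e_j, e_{j-1}, e_{j-2} act by explicit formulas obtained from sl₂-type
-- identities, where characteristic zero is used to cancel factors 2 and 3.
module Submission where

open import Defs
open import Level using (Level; _⊔_; lift)
open import Data.Nat using (ℕ; zero; suc; _+_; _≤_; _<_; z≤n; s≤s)
open import Data.Nat.Properties using (≤-trans; ≤-refl; <⇒≤; n≤1+n; m≤n+m; m≤n⇒m≤1+n; m≤n⇒m<n∨m≡n; m<1+n⇒m≤n; n≮n)
open import Data.List using (List; []; _∷_; _++_)
open import Data.List.Properties using (++-assoc)
open import Data.List.Relation.Unary.All using (All; []; _∷_)
open import Data.List.Relation.Unary.All.Properties using (++⁺)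
open import Data.Product using (Σ; _×_; _,_)
open import Data.Sum using (_⊎_; inj₁; inj₂)
open import Data.Empty using (⊥-elim)
open import Relation.Nullary using (¬_)
open import Relation.Binary.PropositionalEquality as ≡ using (_≡_)
open import Algebra.Bundles using (CommutativeRing; AbelianGroup)
open import Algebra.Module.Bundles using (Module)
import Algebra.Properties.AbelianGroup as AbelianGroupProperties
import Algebra.Properties.CommutativeSemigroup as CommutativeSemigroupProperties
import Algebra.Definitions.RawMonoid as RawMonoidDefinitions

module CharZeroModule {c ℓ m ℓm : Level} {K : CommutativeRing c ℓ} (charZeroK : IsCharZeroField K)
                      (M : Module K m ℓm) where
  open CommutativeRing K using (1#; _*_; *-comm)
  open Module M
  open IsCharZeroField charZeroK
  open RawMonoidDefinitions +ᴹ-rawMonoid using () renaming (_×_ to _×ᴹ_)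
  open import Relation.Binary.Reasoning.Setoid ≈ᴹ-setoid

  natK*ₗ≈× : ∀ k x → natK K k *ₗ x ≈ᴹ k ×ᴹ x
  natK*ₗ≈× zero    x = *ₗ-zeroˡ x
  natK*ₗ≈× (suc k) x = ≈ᴹ-trans (*ₗ-distribʳ x 1# (natK K k)) (+ᴹ-cong (*ₗ-identityˡ x) (natK*ₗ≈× k x))

  ×ᴹ-torsionFree : ∀ k {x} → suc k ×ᴹ x ≈ᴹ 0ᴹ → x ≈ᴹ 0ᴹ
  ×ᴹ-torsionFree k {x} k+1x≈0 with inverse (natK K (suc k)) (charZero k)
  ... | t , [k+1]t≈1 = begin
    x                            ≈⟨ *ₗ-identityˡ x ⟨
    1# *ₗ x                      ≈⟨ *ₗ-congʳ [k+1]t≈1 ⟨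
    (natK K (suc k) * t) *ₗ x    ≈⟨ *ₗ-congʳ (*-comm _ _) ⟩
    (t * natK K (suc k)) *ₗ x    ≈⟨ *ₗ-assoc _ _ _ ⟩
    t *ₗ (natK K (suc k) *ₗ x)   ≈⟨ *ₗ-congˡ (≈ᴹ-trans (natK*ₗ≈× (suc k) x) k+1x≈0) ⟩
    t *ₗ 0ᴹ                      ≈⟨ *ₗ-zeroʳ t ⟩
    0ᴹ                           ∎

module LieAlgebraProperties {c ℓ m ℓm : Level} {K : CommutativeRing c ℓ} (L : LieAlgebra K m ℓm) where
  open CommutativeRing K using (1#; -_; -‿inverseʳ) renaming (_+_ to _+ᴷ_)
  open LieAlgebra L
  open AbelianGroupProperties +ᴹ-abelianGroup
    using (inverseʳ-unique; x∙y⁻¹≈ε⇒x≈y; //-rightDividesˡ; ε⁻¹≈ε; ⁻¹-∙-comm; identityʳ-unique)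
  open AbelianGroupProperties +ᴹ-abelianGroup public
    using () renaming (⁻¹-involutive to -ᴹ-involutive)
  open CommutativeSemigroupProperties (AbelianGroup.commutativeSemigroup +ᴹ-abelianGroup)
    using (interchange; x∙yz≈y∙xz)
  open RawMonoidDefinitions +ᴹ-rawMonoid using () renaming (_×_ to _×ᴹ_)
  open import Relation.Binary.Reasoning.Setoid ≈ᴹ-setoid

  infixl 6 _-ᴹ_
  _-ᴹ_ : Carrierᴹ → Carrierᴹ → Carrierᴹ
  x -ᴹ y = x +ᴹ -ᴹ y

  twice : Carrierᴹ → Carrierᴹ
  twice x = x +ᴹ x

  Commute : Carrierᴹ → Carrierᴹ → Set ℓm
  Commute x y = [ x , y ] ≈ᴹ 0ᴹ

  -ᴹ-zero : ∀ {x} → x ≈ᴹ 0ᴹ → -ᴹ x ≈ᴹ 0ᴹ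
  -ᴹ-zero p = ≈ᴹ-trans (-ᴹ‿cong p) ε⁻¹≈ε

  -ᴹ-flip : ∀ {x y} → x ≈ᴹ -ᴹ y → y ≈ᴹ -ᴹ x
  -ᴹ-flip {x} {y} p = ≈ᴹ-trans (≈ᴹ-sym (-ᴹ-involutive y)) (-ᴹ‿cong (≈ᴹ-sym p))

  +ᴹ-zeroˡ : ∀ {x y z} → x ≈ᴹ 0ᴹ → y ≈ᴹ z → x +ᴹ y ≈ᴹ z
  +ᴹ-zeroˡ p q = ≈ᴹ-trans (+ᴹ-cong p q) (+ᴹ-identityˡ _)

  +ᴹ-zeroʳ : ∀ {x y z} → x ≈ᴹ z → y ≈ᴹ 0ᴹ → x +ᴹ y ≈ᴹ z
  +ᴹ-zeroʳ p q = ≈ᴹ-trans (+ᴹ-cong p q) (+ᴹ-identityʳ _)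

  twice-cong : ∀ {x y} → x ≈ᴹ y → twice x ≈ᴹ twice y
  twice-cong p = +ᴹ-cong p p

  twice-zero : ∀ {x} → x ≈ᴹ 0ᴹ → twice x ≈ᴹ 0ᴹ
  twice-zero p = +ᴹ-zeroˡ p p

  twice-neg : ∀ x → twice (-ᴹ x) ≈ᴹ -ᴹ twice x
  twice-neg x = ⁻¹-∙-comm x x

  -[1+1]*ₗ≈-twice : ∀ x → (- (1# +ᴷ 1#)) *ₗ x ≈ᴹ -ᴹ twice x
  -[1+1]*ₗ≈-twice x = ≈ᴹ-trans -a*ₗx≈-[a*ₗx] (-ᴹ‿cong (≈ᴹ-trans (*ₗ-distribʳ x 1# 1#) (twice-cong (*ₗ-identityˡ x))))
    where
    -a*ₗx≈-[a*ₗx] : (- (1# +ᴷ 1#)) *ₗ x ≈ᴹ -ᴹ ((1# +ᴷ 1#) *ₗ x)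
    -a*ₗx≈-[a*ₗx] = inverseʳ-unique _ _ (≈ᴹ-trans (≈ᴹ-sym (*ₗ-distribʳ x _ _))
                      (≈ᴹ-trans (*ₗ-congʳ (-‿inverseʳ _)) (*ₗ-zeroˡ x)))

  bracket-congˡ : ∀ {x x′ y} → x ≈ᴹ x′ → [ x , y ] ≈ᴹ [ x′ , y ]
  bracket-congˡ p = bracket-cong p ≈ᴹ-refl

  bracket-congʳ : ∀ {x y y′} → y ≈ᴹ y′ → [ x , y ] ≈ᴹ [ x , y′ ]
  bracket-congʳ p = bracket-cong ≈ᴹ-refl p

  bracket-zeroˡ : ∀ x → [ 0ᴹ , x ] ≈ᴹ 0ᴹ
  bracket-zeroˡ x = identityʳ-unique _ _ (≈ᴹ-sym (≈ᴹ-trans (bracket-congˡ (≈ᴹ-sym (+ᴹ-identityʳ 0ᴹ))) (bracket-+ˡ 0ᴹ 0ᴹ x)))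

  bracket-zeroʳ : ∀ x → [ x , 0ᴹ ] ≈ᴹ 0ᴹ
  bracket-zeroʳ x = identityʳ-unique _ _ (≈ᴹ-sym (≈ᴹ-trans (bracket-congʳ (≈ᴹ-sym (+ᴹ-identityʳ 0ᴹ))) (bracket-+ʳ x 0ᴹ 0ᴹ)))

  Commute-zeroˡ : ∀ {x y} → x ≈ᴹ 0ᴹ → Commute x y
  Commute-zeroˡ p = ≈ᴹ-trans (bracket-congˡ p) (bracket-zeroˡ _)

  Commute-zeroʳ : ∀ {x y} → y ≈ᴹ 0ᴹ → Commute x y
  Commute-zeroʳ p = ≈ᴹ-trans (bracket-congʳ p) (bracket-zeroʳ _)

  Commute-respˡ : ∀ {x x′ y} → x ≈ᴹ x′ → Commute x′ y → Commute x y
  Commute-respˡ p q = ≈ᴹ-trans (bracket-congˡ p) q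

  Commute-respʳ : ∀ {x y y′} → y ≈ᴹ y′ → Commute x y′ → Commute x y
  Commute-respʳ p q = ≈ᴹ-trans (bracket-congʳ p) q

  bracket-antisym : ∀ x y → [ x , y ] ≈ᴹ -ᴹ [ y , x ]
  bracket-antisym x y = inverseʳ-unique _ _ (begin
    [ y , x ] +ᴹ [ x , y ]                               ≈⟨ +ᴹ-zeroˡ (alternating x) ≈ᴹ-refl ⟨
    [ x , x ] +ᴹ ([ y , x ] +ᴹ [ x , y ])                ≈⟨ +ᴹ-assoc _ _ _ ⟨
    [ x , x ] +ᴹ [ y , x ] +ᴹ [ x , y ]                  ≈⟨ +ᴹ-zeroʳ ≈ᴹ-refl (alternating y) ⟨
    [ x , x ] +ᴹ [ y , x ] +ᴹ [ x , y ] +ᴹ [ y , y ]     ≈⟨ +ᴹ-assoc _ _ _ ⟩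
    ([ x , x ] +ᴹ [ y , x ]) +ᴹ ([ x , y ] +ᴹ [ y , y ]) ≈⟨ +ᴹ-cong (bracket-+ˡ x y x) (bracket-+ˡ x y y) ⟨
    [ x +ᴹ y , x ] +ᴹ [ x +ᴹ y , y ]                     ≈⟨ bracket-+ʳ _ x y ⟨
    [ x +ᴹ y , x +ᴹ y ]                                  ≈⟨ alternating _ ⟩
    0ᴹ                                                   ∎)

  Commute-sym : ∀ {x y} → Commute x y → Commute y x
  Commute-sym p = ≈ᴹ-trans (bracket-antisym _ _) (-ᴹ-zero p)

  bracket-negʳ : ∀ x y → [ x , -ᴹ y ] ≈ᴹ -ᴹ [ x , y ]
  bracket-negʳ x y = inverseʳ-unique _ _ (≈ᴹ-trans (≈ᴹ-sym (bracket-+ʳ x y (-ᴹ y)))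
    (Commute-zeroʳ (-ᴹ‿inverseʳ y)))

  bracket-negˡ : ∀ x y → [ -ᴹ x , y ] ≈ᴹ -ᴹ [ x , y ]
  bracket-negˡ x y = inverseʳ-unique _ _ (≈ᴹ-trans (≈ᴹ-sym (bracket-+ˡ x (-ᴹ x) y))
    (Commute-zeroˡ (-ᴹ‿inverseʳ x)))

  leibniz′ : ∀ x y z → [ [ x , y ] , z ] ≈ᴹ [ x , [ y , z ] ] -ᴹ [ y , [ x , z ] ]
  leibniz′ x y z = ≈ᴹ-sym (x∙y⁻¹≈ε⇒x≈y _ _ (begin
    [ x , [ y , z ] ] -ᴹ [ y , [ x , z ] ] -ᴹ [ [ x , y ] , z ]
      ≈⟨ +ᴹ-cong (+ᴹ-congˡ [y[zx]]) (bracket-antisym _ _) ⟨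
    [ x , [ y , z ] ] +ᴹ [ y , [ z , x ] ] +ᴹ [ z , [ x , y ] ]
      ≈⟨ jacobi x y z ⟩
    0ᴹ ∎))
    where
    [y[zx]] : [ y , [ z , x ] ] ≈ᴹ -ᴹ [ y , [ x , z ] ]
    [y[zx]] = ≈ᴹ-trans (bracket-congʳ (bracket-antisym z x)) (bracket-negʳ y _)

  leibniz : ∀ x y z → [ x , [ y , z ] ] ≈ᴹ [ [ x , y ] , z ] +ᴹ [ y , [ x , z ] ]
  leibniz x y z = ≈ᴹ-trans (≈ᴹ-sym (//-rightDividesˡ _ _)) (+ᴹ-congʳ (≈ᴹ-sym (leibniz′ x y z)))

  Commute-bracket : ∀ {a y z} → Commute a y → Commute a z → Commute a [ y , z ]
  Commute-bracket {a} {y} {z} p q =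
    ≈ᴹ-trans (leibniz a y z) (+ᴹ-zeroˡ (Commute-zeroˡ p) (Commute-zeroʳ q))

  [a[yz]]≈[y[az]] : ∀ {a y} z → Commute a y → [ a , [ y , z ] ] ≈ᴹ [ y , [ a , z ] ]
  [a[yz]]≈[y[az]] {a} {y} z p = ≈ᴹ-trans (leibniz a y z) (+ᴹ-zeroˡ (Commute-zeroˡ p) ≈ᴹ-refl)

  [a[yz]]≈[[ay]z] : ∀ {a z} y → Commute a z → [ a , [ y , z ] ] ≈ᴹ [ [ a , y ] , z ]
  [a[yz]]≈[[ay]z] {a} {z} y p = ≈ᴹ-trans (leibniz a y z) (+ᴹ-zeroʳ ≈ᴹ-refl (Commute-zeroʳ p))

  [b[b-x]]≈0 : ∀ {b x} → [ b , [ b , x ] ] ≈ᴹ 0ᴹ → [ b , [ b , -ᴹ x ] ] ≈ᴹ 0ᴹ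
  [b[b-x]]≈0 p = ≈ᴹ-trans (bracket-congʳ (bracket-negʳ _ _)) (≈ᴹ-trans (bracket-negʳ _ _) (-ᴹ-zero p))

  Adjacent : Carrierᴹ → Carrierᴹ → Set ℓm
  Adjacent b a = [ b , [ b , a ] ] ≈ᴹ -ᴹ twice b

  Adjacent⇒[b[ab]]≈2b : ∀ {a b} → Adjacent b a → [ b , [ a , b ] ] ≈ᴹ twice b
  Adjacent⇒[b[ab]]≈2b {a} {b} h = begin
    [ b , [ a , b ] ]    ≈⟨ bracket-congʳ (bracket-antisym a b) ⟩
    [ b , -ᴹ [ b , a ] ] ≈⟨ bracket-negʳ _ _ ⟩
    -ᴹ [ b , [ b , a ] ] ≈⟨ -ᴹ‿cong h ⟩
    -ᴹ -ᴹ twice b        ≈⟨ -ᴹ-involutive _ ⟩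
    twice b              ∎

  [b[[ab]y]]≈2[by]-[[ba][by]] : ∀ {a b} y → Adjacent b a →
                                [ b , [ [ a , b ] , y ] ] ≈ᴹ twice [ b , y ] -ᴹ [ [ b , a ] , [ b , y ] ]
  [b[[ab]y]]≈2[by]-[[ba][by]] {a} {b} y h = begin
    [ b , [ [ a , b ] , y ] ]                                   ≈⟨ leibniz _ _ _ ⟩
    [ [ b , [ a , b ] ] , y ] +ᴹ [ [ a , b ] , [ b , y ] ]      ≈⟨ +ᴹ-cong 2[by] -[[ba][by]] ⟩
    twice [ b , y ] -ᴹ [ [ b , a ] , [ b , y ] ]                ∎
    where
    2[by] : [ [ b , [ a , b ] ] , y ] ≈ᴹ twice [ b , y ]
    2[by] = ≈ᴹ-trans (bracket-congˡ (Adjacent⇒[b[ab]]≈2b h)) (bracket-+ˡ b b y)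
    -[[ba][by]] : [ [ a , b ] , [ b , y ] ] ≈ᴹ -ᴹ [ [ b , a ] , [ b , y ] ]
    -[[ba][by]] = ≈ᴹ-trans (bracket-congˡ (bracket-antisym a b)) (bracket-negˡ _ _)

  -- Expanding [b,[a,[b,y]]] once by the Jacobi identity and once through [a,[b,y]] = [[a,b],y]
  -- produces the term [[b,a],[b,y]] with opposite signs.
  2[b[a[by]]]≈2[by]+[a[b[by]]] : ∀ {a b} y → Adjacent b a → Commute a y →
                                 twice [ b , [ a , [ b , y ] ] ] ≈ᴹ twice [ b , y ] +ᴹ [ a , [ b , [ b , y ] ] ]
  2[b[a[by]]]≈2[by]+[a[b[by]]] {a} {b} y h ay≈0 = begin
    X +ᴹ X                 ≈⟨ +ᴹ-cong (leibniz b a [ b , y ]) X≈2P-W ⟩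
    (W +ᴹ T) +ᴹ (P2 -ᴹ W)  ≈⟨ +ᴹ-congʳ (+ᴹ-comm W T) ⟩
    (T +ᴹ W) +ᴹ (P2 -ᴹ W)  ≈⟨ +ᴹ-assoc _ _ _ ⟩
    T +ᴹ (W +ᴹ (P2 -ᴹ W))  ≈⟨ +ᴹ-congˡ (x∙yz≈y∙xz W P2 (-ᴹ W)) ⟩
    T +ᴹ (P2 +ᴹ (W -ᴹ W))  ≈⟨ +ᴹ-congˡ (+ᴹ-zeroʳ ≈ᴹ-refl (-ᴹ‿inverseʳ W)) ⟩
    T +ᴹ P2                ≈⟨ +ᴹ-comm T P2 ⟩
    P2 +ᴹ T                ∎
    where
    X W T P2 : Carrierᴹ
    X = [ b , [ a , [ b , y ] ] ]
    W = [ [ b , a ] , [ b , y ] ]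
    T = [ a , [ b , [ b , y ] ] ]
    P2 = twice [ b , y ]
    X≈2P-W : X ≈ᴹ P2 -ᴹ W
    X≈2P-W = ≈ᴹ-trans (bracket-congʳ ([a[yz]]≈[[ay]z] b ay≈0))
                      ([b[[ab]y]]≈2[by]-[[ba][by]] y h)

  [b[b[cv]]]≈0 : ∀ {b c v u w} → Adjacent b c → [ b , v ] ≈ᴹ u → [ c , u ] ≈ᴹ -ᴹ w →
                 [ b , w ] ≈ᴹ -ᴹ u → Commute b u → [ b , [ b , [ c , v ] ] ] ≈ᴹ 0ᴹ
  [b[b[cv]]]≈0 {b} {c} {v} {u} {w} h bv≈u cu≈-w bw≈-u bu≈0 = begin
    [ b , [ b , [ c , v ] ] ]                                ≈⟨ bracket-congʳ [b[cv]]≈[[bc]v]-w ⟩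
    [ b , [ [ b , c ] , v ] -ᴹ w ]                           ≈⟨ bracket-+ʳ _ _ _ ⟩
    [ b , [ [ b , c ] , v ] ] +ᴹ [ b , -ᴹ w ]                ≈⟨ +ᴹ-cong [b[[bc]v]]≈-2u+u [b-w]≈u ⟩
    (-ᴹ twice u +ᴹ u) +ᴹ u                                   ≈⟨ +ᴹ-assoc _ _ _ ⟩
    -ᴹ twice u +ᴹ twice u                                    ≈⟨ -ᴹ‿inverseˡ _ ⟩
    0ᴹ                                                       ∎
    where
    [b[cv]]≈[[bc]v]-w : [ b , [ c , v ] ] ≈ᴹ [ [ b , c ] , v ] -ᴹ w
    [b[cv]]≈[[bc]v]-w = ≈ᴹ-trans (leibniz b c v) (+ᴹ-congˡ (≈ᴹ-trans (bracket-congʳ bv≈u) cu≈-w))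
    [b-w]≈u : [ b , -ᴹ w ] ≈ᴹ u
    [b-w]≈u = ≈ᴹ-trans (bracket-negʳ _ _) (≈ᴹ-trans (-ᴹ‿cong bw≈-u) (-ᴹ-involutive u))
    [[bc]u]≈u : [ [ b , c ] , u ] ≈ᴹ u
    [[bc]u]≈u = ≈ᴹ-trans (leibniz′ b c u)
      (+ᴹ-zeroʳ (≈ᴹ-trans (bracket-congʳ cu≈-w) [b-w]≈u) (-ᴹ-zero (Commute-zeroʳ bu≈0)))
    [b[[bc]v]]≈-2u+u : [ b , [ [ b , c ] , v ] ] ≈ᴹ -ᴹ twice u +ᴹ u
    [b[[bc]v]]≈-2u+u = begin
      [ b , [ [ b , c ] , v ] ]                                ≈⟨ leibniz _ _ _ ⟩
      [ [ b , [ b , c ] ] , v ] +ᴹ [ [ b , c ] , [ b , v ] ]   ≈⟨ +ᴹ-cong (bracket-congˡ h) (bracket-congʳ bv≈u) ⟩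
      [ -ᴹ twice b , v ] +ᴹ [ [ b , c ] , u ]                  ≈⟨ +ᴹ-cong (bracket-negˡ _ _) [[bc]u]≈u ⟩
      -ᴹ [ twice b , v ] +ᴹ u                                  ≈⟨ +ᴹ-congʳ (-ᴹ‿cong (≈ᴹ-trans (bracket-+ˡ _ _ _) (twice-cong bv≈u))) ⟩
      -ᴹ twice u +ᴹ u                                          ∎

  -- ad a is a derivation vanishing on z, so ad a ⁴ [x,[x,z]] expands binomially over the pairs
  -- [(ad a)ⁱ x,[(ad a)ʲ x,z]] with i + j = 4; as (ad a)³ x = 0 only the six terms with i = j = 2 remain.
  ad⁴[x[xz]]≈6[x₂[x₂z]] : ∀ {a x z} → [ a , [ a , [ a , x ] ] ] ≈ᴹ 0ᴹ → Commute a z →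
    let x₂ = [ a , [ a , x ] ] ; t = [ x₂ , [ x₂ , z ] ] in
    [ a , [ a , [ a , [ a , [ x , [ x , z ] ] ] ] ] ] ≈ᴹ (t +ᴹ (t +ᴹ t)) +ᴹ (t +ᴹ (t +ᴹ t))
  ad⁴[x[xz]]≈6[x₂[x₂z]] {a} {x} {z} a³x≈0 az≈0 =
    ≈ᴹ-trans (bracket-congʳ ad³) (≈ᴹ-trans (bracket-+ʳ _ _ _) (+ᴹ-cong
      (≈ᴹ-trans (bracket-+ʳ _ _ _) (+ᴹ-cong α[x₂x₁] (≈ᴹ-trans (bracket-+ʳ _ _ _) (+ᴹ-cong α[x₂x₁] α[x₁x₂]))))
      (≈ᴹ-trans (bracket-+ʳ _ _ _) (≈ᴹ-trans (+ᴹ-cong (≈ᴹ-trans (bracket-+ʳ _ _ _) (+ᴹ-cong α[x₂x₁] α[x₁x₂])) α[x₁x₂])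
        (+ᴹ-assoc t t t)))))
    where
    α : Carrierᴹ → Carrierᴹ
    α = [ a ,_]
    B : Carrierᴹ → Carrierᴹ → Carrierᴹ
    B y y′ = [ y , [ y′ , z ] ]
    x₁ x₂ t : Carrierᴹ
    x₁ = α x
    x₂ = α x₁
    t = B x₂ x₂
    α-B : ∀ y y′ → α (B y y′) ≈ᴹ B (α y) y′ +ᴹ B y (α y′)
    α-B y y′ = ≈ᴹ-trans (leibniz a y _) (+ᴹ-congˡ (bracket-congʳ (≈ᴹ-trans (leibniz a y′ z)
                 (+ᴹ-zeroʳ ≈ᴹ-refl (Commute-zeroʳ az≈0)))))
    B-α³ˡ : ∀ y → B (α x₂) y ≈ᴹ 0ᴹ
    B-α³ˡ y = Commute-zeroˡ a³x≈0
    B-α³ʳ : ∀ y → B y (α x₂) ≈ᴹ 0ᴹ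
    B-α³ʳ y = Commute-zeroʳ (Commute-zeroˡ a³x≈0)
    α[x₂x₁] : α (B x₂ x₁) ≈ᴹ t
    α[x₂x₁] = ≈ᴹ-trans (α-B x₂ x₁) (+ᴹ-zeroˡ (B-α³ˡ x₁) ≈ᴹ-refl)
    α[x₁x₂] : α (B x₁ x₂) ≈ᴹ t
    α[x₁x₂] = ≈ᴹ-trans (α-B x₁ x₂) (+ᴹ-zeroʳ ≈ᴹ-refl (B-α³ʳ x₁))
    ad² : α (α (B x x)) ≈ᴹ (B x₂ x +ᴹ B x₁ x₁) +ᴹ (B x₁ x₁ +ᴹ B x x₂)
    ad² = ≈ᴹ-trans (bracket-congʳ (α-B x x)) (≈ᴹ-trans (bracket-+ʳ _ _ _) (+ᴹ-cong (α-B x₁ x) (α-B x x₁)))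
    ad³ : α (α (α (B x x))) ≈ᴹ (B x₂ x₁ +ᴹ (B x₂ x₁ +ᴹ B x₁ x₂)) +ᴹ ((B x₂ x₁ +ᴹ B x₁ x₂) +ᴹ B x₁ x₂)
    ad³ = ≈ᴹ-trans (bracket-congʳ ad²) (≈ᴹ-trans (bracket-+ʳ _ _ _) (+ᴹ-cong
            (≈ᴹ-trans (bracket-+ʳ _ _ _) (+ᴹ-cong (≈ᴹ-trans (α-B x₂ x) (+ᴹ-zeroˡ (B-α³ˡ x) ≈ᴹ-refl)) (α-B x₁ x₁)))
            (≈ᴹ-trans (bracket-+ʳ _ _ _) (+ᴹ-cong (α-B x₁ x₁) (≈ᴹ-trans (α-B x x₂) (+ᴹ-zeroʳ ≈ᴹ-refl (B-α³ʳ x)))))))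

  Span-Commuteˡ : ∀ {P z} → (∀ {x} → P x → Commute x z) → ∀ {x} → Span L P x → Commute x z
  Span-Commuteˡ f (gen p)     = f p
  Span-Commuteˡ f zero        = bracket-zeroˡ _
  Span-Commuteˡ f (add s t)   = ≈ᴹ-trans (bracket-+ˡ _ _ _) (+ᴹ-zeroˡ (Span-Commuteˡ f s) (Span-Commuteˡ f t))
  Span-Commuteˡ f (smul a s)  = ≈ᴹ-trans (bracket-*ˡ a _ _) (≈ᴹ-trans (*ₗ-congˡ (Span-Commuteˡ f s)) (*ₗ-zeroʳ a))
  Span-Commuteˡ f (resp eq s) = Commute-respˡ (≈ᴹ-sym eq) (Span-Commuteˡ f s)

  Span-abelian : ∀ {P} → (∀ {x y} → P x → P y → Commute x y) → ∀ {x y} → Span L P x → Span L P y → Commute x y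
  Span-abelian f sx sy = Span-Commuteˡ (λ px → Commute-sym (Span-Commuteˡ (λ py → f py px) sy)) sx

  module TorsionFree (×ᴹ-torsionFree : ∀ k {x} → suc k ×ᴹ x ≈ᴹ 0ᴹ → x ≈ᴹ 0ᴹ) where

    twice≈0⇒≈0 : ∀ {x} → twice x ≈ᴹ 0ᴹ → x ≈ᴹ 0ᴹ
    twice≈0⇒≈0 p = ×ᴹ-torsionFree 1 (≈ᴹ-trans (+ᴹ-congˡ (+ᴹ-identityʳ _)) p)

    thrice≈0⇒≈0 : ∀ {x} → x +ᴹ (x +ᴹ x) ≈ᴹ 0ᴹ → x ≈ᴹ 0ᴹ
    thrice≈0⇒≈0 p = ×ᴹ-torsionFree 2 (≈ᴹ-trans (+ᴹ-congˡ (+ᴹ-congˡ (+ᴹ-identityʳ _))) p)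

    x≈-x⇒x≈0 : ∀ {x} → x ≈ᴹ -ᴹ x → x ≈ᴹ 0ᴹ
    x≈-x⇒x≈0 {x} p = twice≈0⇒≈0 (≈ᴹ-trans (+ᴹ-congʳ p) (-ᴹ‿inverseˡ x))

    twice-injective : ∀ {x y} → twice x ≈ᴹ twice y → x ≈ᴹ y
    twice-injective {x} {y} p = x∙y⁻¹≈ε⇒x≈y x y (twice≈0⇒≈0 (begin
      twice (x -ᴹ y)           ≈⟨ interchange _ _ _ _ ⟩
      twice x +ᴹ twice (-ᴹ y)  ≈⟨ +ᴹ-cong p (twice-neg y) ⟩
      twice y -ᴹ twice y       ≈⟨ -ᴹ‿inverseʳ _ ⟩
      0ᴹ                       ∎))

    [b[a[bc]]]≈[bc]-[ab] : ∀ {a b c} → Adjacent b a → Adjacent b c → Commute a c →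
                           [ b , [ a , [ b , c ] ] ] ≈ᴹ [ b , c ] -ᴹ [ a , b ]
    [b[a[bc]]]≈[bc]-[ab] {a} {b} {c} ba bc ac≈0 = twice-injective (begin
      twice [ b , [ a , [ b , c ] ] ]                   ≈⟨ 2[b[a[by]]]≈2[by]+[a[b[by]]] c ba ac≈0 ⟩
      twice [ b , c ] +ᴹ [ a , [ b , [ b , c ] ] ]      ≈⟨ +ᴹ-congˡ (bracket-congʳ bc) ⟩
      twice [ b , c ] +ᴹ [ a , -ᴹ twice b ]             ≈⟨ +ᴹ-congˡ (≈ᴹ-trans (bracket-negʳ _ _) (-ᴹ‿cong (bracket-+ʳ _ _ _))) ⟩
      twice [ b , c ] -ᴹ twice [ a , b ]                ≈⟨ +ᴹ-congˡ (twice-neg _) ⟨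
      twice [ b , c ] +ᴹ twice (-ᴹ [ a , b ])           ≈⟨ interchange _ _ _ _ ⟨
      twice ([ b , c ] -ᴹ [ a , b ])                    ∎)

    [b[a[b[cd]]]]≈[b[cd]] : ∀ {a b c d} → Adjacent b a → Adjacent b c →
                            Commute a c → Commute a d → Commute b d →
                            [ b , [ a , [ b , [ c , d ] ] ] ] ≈ᴹ [ b , [ c , d ] ]
    [b[a[b[cd]]]]≈[b[cd]] {a} {b} {c} {d} ba bc ac≈0 ad≈0 bd≈0 = twice-injective (begin
      twice [ b , [ a , [ b , [ c , d ] ] ] ]                   ≈⟨ 2[b[a[by]]]≈2[by]+[a[b[by]]] _ ba (Commute-bracket ac≈0 ad≈0) ⟩
      twice [ b , [ c , d ] ] +ᴹ [ a , [ b , [ b , [ c , d ] ] ] ] ≈⟨ +ᴹ-zeroʳ ≈ᴹ-refl (Commute-zeroʳ [b[b[cd]]]≈0) ⟩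
      twice [ b , [ c , d ] ]                                   ∎)
      where
      [b[b[cd]]]≈0 : [ b , [ b , [ c , d ] ] ] ≈ᴹ 0ᴹ
      [b[b[cd]]]≈0 = begin
        [ b , [ b , [ c , d ] ] ]                              ≈⟨ bracket-congʳ ([a[yz]]≈[[ay]z] c bd≈0) ⟩
        [ b , [ [ b , c ] , d ] ]                              ≈⟨ leibniz _ _ _ ⟩
        [ [ b , [ b , c ] ] , d ] +ᴹ [ [ b , c ] , [ b , d ] ]  ≈⟨ +ᴹ-zeroʳ (bracket-congˡ bc) (Commute-zeroʳ bd≈0) ⟩
        [ -ᴹ twice b , d ]                                     ≈⟨ bracket-negˡ _ _ ⟩
        -ᴹ [ twice b , d ]                                     ≈⟨ -ᴹ-zero (≈ᴹ-trans (bracket-+ˡ _ _ _) (twice-zero bd≈0)) ⟩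
        0ᴹ                                                     ∎

    [x₂[x₂z]]≈0 : ∀ {a x z} → [ a , [ a , [ a , x ] ] ] ≈ᴹ 0ᴹ → Commute a z → Adjacent x z →
                  [ [ a , [ a , x ] ] , [ [ a , [ a , x ] ] , z ] ] ≈ᴹ 0ᴹ
    [x₂[x₂z]]≈0 {a} {x} {z} a³x≈0 az≈0 xz =
      thrice≈0⇒≈0 (twice≈0⇒≈0 (≈ᴹ-trans (≈ᴹ-sym (ad⁴[x[xz]]≈6[x₂[x₂z]] a³x≈0 az≈0)) ad⁴[x[xz]]≈0))
      where
      ad-twice-neg : ∀ y → [ a , -ᴹ twice y ] ≈ᴹ -ᴹ twice [ a , y ]
      ad-twice-neg y = ≈ᴹ-trans (bracket-negʳ a _) (-ᴹ‿cong (bracket-+ʳ a y y))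
      ad⁴[x[xz]]≈0 : [ a , [ a , [ a , [ a , [ x , [ x , z ] ] ] ] ] ] ≈ᴹ 0ᴹ
      ad⁴[x[xz]]≈0 = begin
        [ a , [ a , [ a , [ a , [ x , [ x , z ] ] ] ] ] ]  ≈⟨ bracket-congʳ (bracket-congʳ (bracket-congʳ (bracket-congʳ xz))) ⟩
        [ a , [ a , [ a , [ a , -ᴹ twice x ] ] ] ]         ≈⟨ bracket-congʳ (bracket-congʳ (bracket-congʳ (ad-twice-neg x))) ⟩
        [ a , [ a , [ a , -ᴹ twice [ a , x ] ] ] ]         ≈⟨ bracket-congʳ (bracket-congʳ (ad-twice-neg _)) ⟩
        [ a , [ a , -ᴹ twice [ a , [ a , x ] ] ] ]         ≈⟨ bracket-congʳ (ad-twice-neg _) ⟩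
        [ a , -ᴹ twice [ a , [ a , [ a , x ] ] ] ]         ≈⟨ ad-twice-neg _ ⟩
        -ᴹ twice [ a , [ a , [ a , [ a , x ] ] ] ]         ≈⟨ -ᴹ-zero (twice-zero (Commute-zeroʳ a³x≈0)) ⟩
        0ᴹ                                                ∎

    [a[bu]]≈u : ∀ {a b u v} → Adjacent a b → Commute a u → u ≈ᴹ -ᴹ [ a , v ] →
                [ a , [ a , [ b , v ] ] ] ≈ᴹ 0ᴹ → [ a , [ b , u ] ] ≈ᴹ u
    [a[bu]]≈u {a} {b} {u} {v} ab au≈0 u≈-av a²bv≈0 = twice-injective (begin
      Z +ᴹ Z                                  ≈⟨ +ᴹ-congʳ Z≈-[-2u+Z] ⟩
      -ᴹ (twice (-ᴹ u) +ᴹ Z) +ᴹ Z             ≈⟨ +ᴹ-congʳ (⁻¹-∙-comm _ _) ⟨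
      -ᴹ twice (-ᴹ u) +ᴹ -ᴹ Z +ᴹ Z            ≈⟨ +ᴹ-assoc _ _ _ ⟩
      -ᴹ twice (-ᴹ u) +ᴹ (-ᴹ Z +ᴹ Z)          ≈⟨ +ᴹ-zeroʳ (-ᴹ‿cong (twice-neg u)) (-ᴹ‿inverseˡ Z) ⟩
      -ᴹ -ᴹ twice u                           ≈⟨ -ᴹ-involutive _ ⟩
      twice u                                 ∎)
      where
      Z h : Carrierᴹ
      Z = [ a , [ b , u ] ]
      h = [ a , b ]
      av≈-u : [ a , v ] ≈ᴹ -ᴹ u
      av≈-u = -ᴹ-flip u≈-av
      [ha]≈2a : [ h , a ] ≈ᴹ twice a
      [ha]≈2a = ≈ᴹ-trans (bracket-antisym h a) (≈ᴹ-trans (-ᴹ‿cong ab) (-ᴹ-involutive _))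
      [[ha]v]≈-2u : [ [ h , a ] , v ] ≈ᴹ twice (-ᴹ u)
      [[ha]v]≈-2u = ≈ᴹ-trans (bracket-congˡ [ha]≈2a) (≈ᴹ-trans (bracket-+ˡ a a v) (twice-cong av≈-u))
      [a[hv]]≈Z : [ a , [ h , v ] ] ≈ᴹ Z
      [a[hv]]≈Z = begin
        [ a , [ h , v ] ]                               ≈⟨ bracket-congʳ (leibniz′ a b v) ⟩
        [ a , [ a , [ b , v ] ] -ᴹ [ b , [ a , v ] ] ]  ≈⟨ bracket-+ʳ _ _ _ ⟩
        [ a , [ a , [ b , v ] ] ] +ᴹ [ a , -ᴹ [ b , [ a , v ] ] ]
          ≈⟨ +ᴹ-zeroˡ a²bv≈0 (bracket-congʳ (≈ᴹ-trans (-ᴹ‿cong (≈ᴹ-trans (bracket-congʳ av≈-u) (bracket-negʳ b u))) (-ᴹ-involutive _))) ⟩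
        Z                                               ∎
      Z≈-[-2u+Z] : Z ≈ᴹ -ᴹ (twice (-ᴹ u) +ᴹ Z)
      Z≈-[-2u+Z] = begin
        Z                                     ≈⟨ [a[yz]]≈[[ay]z] b au≈0 ⟩
        [ h , u ]                             ≈⟨ bracket-congʳ u≈-av ⟩
        [ h , -ᴹ [ a , v ] ]                  ≈⟨ bracket-negʳ _ _ ⟩
        -ᴹ [ h , [ a , v ] ]                  ≈⟨ -ᴹ‿cong (leibniz h a v) ⟩
        -ᴹ ([ [ h , a ] , v ] +ᴹ [ a , [ h , v ] ])  ≈⟨ -ᴹ‿cong (+ᴹ-cong [[ha]v]≈-2u [a[hv]]≈Z) ⟩
        -ᴹ (twice (-ᴹ u) +ᴹ Z)                ∎

≤-suc-cases : ∀ {k b} → k ≤ suc b → k ≤ b ⊎ k ≡ suc b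
≤-suc-cases k≤1+b with m≤n⇒m<n∨m≡n k≤1+b
... | inj₁ k<1+b = inj₁ (m<1+n⇒m≤n k<1+b)
... | inj₂ k≡1+b = inj₂ k≡1+b

¬[i≡1×j≡2]⇒3≤j : ∀ {i j} → 1 ≤ i → i < j → ¬ ((i ≡ 1) × (j ≡ 2)) → 3 ≤ j
¬[i≡1×j≡2]⇒3≤j {1}     {2}               _ _                  ≢12 = ⊥-elim (≢12 (≡.refl , ≡.refl))
¬[i≡1×j≡2]⇒3≤j {1}     {1}               _ (s≤s ())           _
¬[i≡1×j≡2]⇒3≤j {suc (suc i)} {2}         _ (s≤s (s≤s ()))     _
¬[i≡1×j≡2]⇒3≤j {_}     {suc (suc (suc j))} _ _                _   = s≤s (s≤s (s≤s z≤n))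

module Electrical {κ κ′ μ μ′ : Level} {K : CommutativeRing κ κ′} (charZeroK : IsCharZeroField K)
                  (L : LieAlgebra K μ μ′) {n : ℕ} {e : ℕ → LieAlgebra.Carrierᴹ L}
                  (R : ElectricalCRelations L n e) where
  open LieAlgebra L
  open LieAlgebraProperties L
  open TorsionFree (CharZeroModule.×ᴹ-torsionFree charZeroK module′)
  open ElectricalCRelations R
  open import Relation.Binary.Reasoning.Setoid ≈ᴹ-setoid

  ≡⇒≈ᴹ : ∀ {x y} → x ≡ y → x ≈ᴹ y
  ≡⇒≈ᴹ ≡.refl = ≈ᴹ-refl

  [eᵢ,eⱼ]≈0 : ∀ {i j} → 1 ≤ i → 2 + i ≤ j → j ≤ n → Commute (e i) (e j)
  [eᵢ,eⱼ]≈0 {i} {j} 1≤i i+2≤j j≤n =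
    far i j 1≤i (≤-trans (m≤n+m i 2) (≤-trans i+2≤j j≤n)) (≤-trans (s≤s z≤n) i+2≤j) j≤n (inj₁ i+2≤j)

  Adjacent-eᵢ-eᵢ₊₁ : ∀ {i} → 2 ≤ i → suc i ≤ n → Adjacent (e i) (e (suc i))
  Adjacent-eᵢ-eᵢ₊₁ {suc zero}    (s≤s ()) _
  Adjacent-eᵢ-eᵢ₊₁ {suc (suc i)} _        i+1≤n =
    ≈ᴹ-trans (near _ _ (s≤s z≤n) (<⇒≤ i+1≤n) (s≤s z≤n) i+1≤n (inj₁ ≡.refl) (λ ())) (-[1+1]*ₗ≈-twice _)

  Adjacent-eᵢ₊₁-eᵢ : ∀ {i} → 1 ≤ i → suc i ≤ n → Adjacent (e (suc i)) (e i)
  Adjacent-eᵢ₊₁-eᵢ {suc i} _ i+1≤n =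
    ≈ᴹ-trans (near _ _ (s≤s z≤n) i+1≤n (s≤s z≤n) (<⇒≤ i+1≤n) (inj₂ ≡.refl) (λ ())) (-[1+1]*ₗ≈-twice _)

  ad* : List ℕ → Carrierᴹ → Carrierᴹ
  ad* []       z = z
  ad* (k ∷ ks) z = [ e k , ad* ks z ]

  ad*-cong : ∀ ks {x y} → x ≈ᴹ y → ad* ks x ≈ᴹ ad* ks y
  ad*-cong []       p = p
  ad*-cong (k ∷ ks) p = bracket-congʳ (ad*-cong ks p)

  ad*-zero : ∀ ks {x} → x ≈ᴹ 0ᴹ → ad* ks x ≈ᴹ 0ᴹ
  ad*-zero []       p = p
  ad*-zero (k ∷ ks) p = Commute-zeroʳ (ad*-zero ks p)

  ad*-neg : ∀ ks x → ad* ks (-ᴹ x) ≈ᴹ -ᴹ ad* ks x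
  ad*-neg []       x = ≈ᴹ-refl
  ad*-neg (k ∷ ks) x = ≈ᴹ-trans (bracket-congʳ (ad*-neg ks x)) (bracket-negʳ _ _)

  ad*-+ : ∀ ks x y → ad* ks (x +ᴹ y) ≈ᴹ ad* ks x +ᴹ ad* ks y
  ad*-+ []       x y = ≈ᴹ-refl
  ad*-+ (k ∷ ks) x y = ≈ᴹ-trans (bracket-congʳ (ad*-+ ks x y)) (bracket-+ʳ _ _ _)

  ad*-++ : ∀ ks ls z → ad* (ks ++ ls) z ≡ ad* ks (ad* ls z)
  ad*-++ []       ls z = ≡.refl
  ad*-++ (k ∷ ks) ls z = ≡.cong [ e k ,_] (ad*-++ ks ls z)

  InRange : ℕ → ℕ → Set
  InRange b k = 1 ≤ k × k ≤ b

  [eₐ,ad*]≈ad*[eₐ,-] : ∀ {a b} ks z → 2 + b ≤ a → a ≤ n → All (InRange b) ks →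
                       [ e a , ad* ks z ] ≈ᴹ ad* ks [ e a , z ]
  [eₐ,ad*]≈ad*[eₐ,-] []       z _     _   []               = ≈ᴹ-refl
  [eₐ,ad*]≈ad*[eₐ,-] (k ∷ ks) z b+2≤a a≤n ((1≤k , k≤b) ∷ r) =
    ≈ᴹ-trans ([a[yz]]≈[y[az]] _ (Commute-sym ([eᵢ,eⱼ]≈0 1≤k (≤-trans (s≤s (s≤s k≤b)) b+2≤a) a≤n)))
             (bracket-congʳ ([eₐ,ad*]≈ad*[eₐ,-] ks z b+2≤a a≤n r))

  U : ℕ → ℕ → Carrierᴹ
  U = u L e

  path : ℕ → ℕ → List ℕ
  path i j = down L i ++ up L j

  down-InRange : ∀ {i b} → i ≤ b → All (InRange b) (down L i)
  down-InRange {zero}  _     = []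
  down-InRange {suc i} 1+i≤b = (s≤s z≤n , 1+i≤b) ∷ down-InRange (<⇒≤ 1+i≤b)

  up-InRange : ∀ {j b} → j ≤ b → All (InRange b) (up L j)
  up-InRange {zero}  _     = []
  up-InRange {suc j} 1+j≤b = ++⁺ (up-InRange (<⇒≤ 1+j≤b)) ((s≤s z≤n , 1+j≤b) ∷ [])

  [eₐ,ad*path]≈ad*path[eₐ,-] : ∀ {a b i j} z → i ≤ b → j ≤ b → 2 + b ≤ a → a ≤ n →
                               [ e a , ad* (path i j) z ] ≈ᴹ ad* (path i j) [ e a , z ]
  [eₐ,ad*path]≈ad*path[eₐ,-] {i = i} {j} z i≤b j≤b b+2≤a a≤n =
    [eₐ,ad*]≈ad*[eₐ,-] (path i j) z b+2≤a a≤n (++⁺ (down-InRange i≤b) (up-InRange j≤b))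

  ad*-path-suc : ∀ i j z → ad* (path i (suc j)) z ≡ ad* (path i j) [ e (suc j) , z ]
  ad*-path-suc i j z = ≡.trans (≡.cong (λ ks → ad* ks z) (≡.sym (++-assoc (down L i) (up L j) (suc j ∷ []))))
                               (ad*-++ (path i j) (suc j ∷ []) z)

  U≡ad*₀ : ∀ i j → U (suc i) (suc j) ≡ ad* (path (suc i) j) (e (suc j))
  U≡ad*₀ i j = ≡.trans (≡.cong (nest L e (suc i)) (≡.sym (++-assoc (down L i) (up L j) (suc j ∷ []))))
                       (nest≡ad* (suc i) (down L i ++ up L j) (suc j))
    where
    nest≡ad* : ∀ k ks x → nest L e k (ks ++ x ∷ []) ≡ ad* (k ∷ ks) (e x)
    nest≡ad* k []        x = ≡.refl
    nest≡ad* k (k′ ∷ ks) x = ≡.cong [ e k ,_] (nest≡ad* k′ ks x)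

  U≡ad*₁ : ∀ i j → U (suc i) (2 + j) ≡ ad* (path (suc i) j) [ e (suc j) , e (2 + j) ]
  U≡ad*₁ i j = ≡.trans (U≡ad*₀ i (suc j)) (ad*-path-suc (suc i) j _)

  U≡ad*₂ : ∀ i j → U (suc i) (3 + j) ≡ ad* (path (suc i) j) [ e (suc j) , [ e (2 + j) , e (3 + j) ] ]
  U≡ad*₂ i j = ≡.trans (U≡ad*₁ i (suc j)) (ad*-path-suc (suc i) j _)

  U≡ad*₃ : ∀ i j → U (suc i) (4 + j) ≡ ad* (path (suc i) j) [ e (suc j) , [ e (2 + j) , [ e (3 + j) , e (4 + j) ] ] ]
  U≡ad*₃ i j = ≡.trans (U≡ad*₂ i (suc j)) (ad*-path-suc (suc i) j _)

  [eₐ,uᵢⱼ]≈0 : ∀ {a i j} → 1 ≤ i → i < j → 2 + j ≤ a → a ≤ n → Commute (e a) (U i j)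
  [eₐ,uᵢⱼ]≈0 {a} {suc i} {suc j} _ i<j j+2≤a a≤n = begin
    [ e a , U (suc i) (suc j) ]               ≡⟨ ≡.cong [ e a ,_] (U≡ad*₀ i j) ⟩
    [ e a , ad* (path (suc i) j) (e (suc j)) ] ≈⟨ [eₐ,ad*path]≈ad*path[eₐ,-] _ (<⇒≤ i<j) (n≤1+n j) j+2≤a a≤n ⟩
    ad* (path (suc i) j) [ e a , e (suc j) ]   ≈⟨ ad*-zero (path (suc i) j) (Commute-sym ([eᵢ,eⱼ]≈0 (s≤s z≤n) j+2≤a a≤n)) ⟩
    0ᴹ                                         ∎

  [eⱼ₊₁,uᵢⱼ]≈-uᵢⱼ₊₁ : ∀ {i j} → 1 ≤ i → i < j → suc j ≤ n → [ e (suc j) , U i j ] ≈ᴹ -ᴹ U i (suc j)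
  [eⱼ₊₁,uᵢⱼ]≈-uᵢⱼ₊₁ {suc i} {suc j} _ (s≤s i<j) j+1≤n = begin
    [ e (2 + j) , U (suc i) (suc j) ]        ≡⟨ ≡.cong [ e (2 + j) ,_] (U≡ad*₀ i j) ⟩
    [ e (2 + j) , ad* P (e (suc j)) ]        ≈⟨ [eₐ,ad*path]≈ad*path[eₐ,-] _ i<j ≤-refl ≤-refl j+1≤n ⟩
    ad* P [ e (2 + j) , e (suc j) ]          ≈⟨ ad*-cong P (bracket-antisym _ _) ⟩
    ad* P (-ᴹ [ e (suc j) , e (2 + j) ])     ≈⟨ ad*-neg P _ ⟩
    -ᴹ ad* P [ e (suc j) , e (2 + j) ]       ≡⟨ ≡.cong -ᴹ_ (U≡ad*₁ i j) ⟨
    -ᴹ U (suc i) (2 + j)                     ∎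
    where
    P : List ℕ
    P = path (suc i) j

  [uᵢⱼ,eⱼ₊₁]≈uᵢⱼ₊₁ : ∀ {i j} → 1 ≤ i → i < j → suc j ≤ n → [ U i j , e (suc j) ] ≈ᴹ U i (suc j)
  [uᵢⱼ,eⱼ₊₁]≈uᵢⱼ₊₁ 1≤i i<j j+1≤n =
    ≈ᴹ-trans (bracket-antisym _ _) (≈ᴹ-trans (-ᴹ‿cong ([eⱼ₊₁,uᵢⱼ]≈-uᵢⱼ₊₁ 1≤i i<j j+1≤n)) (-ᴹ-involutive _))

  [eⱼ,uᵢⱼ]≈0 : ∀ {i j} → 1 ≤ i → 2 + i ≤ j → j ≤ n → Commute (e j) (U i j)
  [eⱼ,uᵢⱼ]≈0 {suc i} {suc (suc (suc j))} _ (s≤s (s≤s i≤j)) j≤n = begin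
    [ e c , U (suc i) c ]              ≡⟨ ≡.cong [ e c ,_] (U≡ad*₁ i (suc j)) ⟩
    [ e c , ad* P [ e b , e c ] ]      ≈⟨ [eₐ,ad*path]≈ad*path[eₐ,-] _ i≤j ≤-refl ≤-refl j≤n ⟩
    ad* P [ e c , [ e b , e c ] ]      ≈⟨ ad*-cong P (Adjacent⇒[b[ab]]≈2b (Adjacent-eᵢ₊₁-eᵢ (s≤s z≤n) j≤n)) ⟩
    ad* P (twice (e c))                ≈⟨ ad*-+ P _ _ ⟩
    twice (ad* P (e c))                ≈⟨ twice-zero Pc≈0 ⟩
    0ᴹ                                 ∎
    where
    b c : ℕ
    b = 2 + j
    c = 3 + j
    P : List ℕ
    P = path (suc i) (suc j)
    Pc≈0 : ad* P (e c) ≈ᴹ 0ᴹ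
    Pc≈0 = ≈ᴹ-trans (≡⇒≈ᴹ (ad*-path-suc (suc i) j _))
                    (ad*-zero (path (suc i) j) ([eᵢ,eⱼ]≈0 (s≤s z≤n) ≤-refl j≤n))

  [eⱼ,uᵢⱼ₊₁]≈-uᵢⱼ : ∀ {i j} → 1 ≤ i → 2 + i ≤ j → suc j ≤ n → [ e j , U i (suc j) ] ≈ᴹ -ᴹ U i j
  [eⱼ,uᵢⱼ₊₁]≈-uᵢⱼ {suc i} {suc (suc (suc j))} _ (s≤s (s≤s i≤j)) c≤n = begin
    [ e b , U (suc i) c ]                           ≡⟨ ≡.cong [ e b ,_] (U≡ad*₂ i (suc j)) ⟩
    [ e b , ad* P [ e a , [ e b , e c ] ] ]         ≈⟨ [eₐ,ad*path]≈ad*path[eₐ,-] _ i≤j ≤-refl ≤-refl b≤n ⟩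
    ad* P [ e b , [ e a , [ e b , e c ] ] ]         ≈⟨ ad*-cong P ([b[a[bc]]]≈[bc]-[ab]
                                                         (Adjacent-eᵢ₊₁-eᵢ (s≤s z≤n) b≤n)
                                                         (Adjacent-eᵢ-eᵢ₊₁ (s≤s (s≤s z≤n)) c≤n)
                                                         ([eᵢ,eⱼ]≈0 (s≤s z≤n) ≤-refl c≤n)) ⟩
    ad* P ([ e b , e c ] -ᴹ [ e a , e b ])          ≈⟨ ad*-+ P _ _ ⟩
    ad* P [ e b , e c ] +ᴹ ad* P (-ᴹ [ e a , e b ]) ≈⟨ +ᴹ-zeroˡ Pbc≈0 (ad*-neg P _) ⟩
    -ᴹ ad* P [ e a , e b ]                          ≡⟨ ≡.cong -ᴹ_ (U≡ad*₁ i (suc j)) ⟨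
    -ᴹ U (suc i) b                                  ∎
    where
    a b c : ℕ
    a = 2 + j
    b = 3 + j
    c = 4 + j
    b≤n : b ≤ n
    b≤n = <⇒≤ c≤n
    P : List ℕ
    P = path (suc i) (suc j)
    Pbc≈0 : ad* P [ e b , e c ] ≈ᴹ 0ᴹ
    Pbc≈0 = ≈ᴹ-trans (≡⇒≈ᴹ (ad*-path-suc (suc i) j _)) (ad*-zero (path (suc i) j)
              (Commute-bracket ([eᵢ,eⱼ]≈0 (s≤s z≤n) ≤-refl b≤n) ([eᵢ,eⱼ]≈0 (s≤s z≤n) (n≤1+n _) c≤n)))

  [eⱼ,uᵢⱼ₊₂]≈0 : ∀ {i j} → 1 ≤ i → 2 + i ≤ j → 2 + j ≤ n → Commute (e j) (U i (2 + j))
  [eⱼ,uᵢⱼ₊₂]≈0 {suc i} {suc (suc (suc j))} _ (s≤s (s≤s i≤j)) d≤n = begin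
    [ e b , U (suc i) d ]                                ≡⟨ ≡.cong [ e b ,_] (U≡ad*₃ i (suc j)) ⟩
    [ e b , ad* P [ e a , [ e b , [ e c , e d ] ] ] ]    ≈⟨ [eₐ,ad*path]≈ad*path[eₐ,-] _ i≤j ≤-refl ≤-refl b≤n ⟩
    ad* P [ e b , [ e a , [ e b , [ e c , e d ] ] ] ]    ≈⟨ ad*-cong P ([b[a[b[cd]]]]≈[b[cd]]
                                                              (Adjacent-eᵢ₊₁-eᵢ (s≤s z≤n) b≤n)
                                                              (Adjacent-eᵢ-eᵢ₊₁ (s≤s (s≤s z≤n)) c≤n)
                                                              ([eᵢ,eⱼ]≈0 (s≤s z≤n) ≤-refl c≤n)
                                                              ([eᵢ,eⱼ]≈0 (s≤s z≤n) (n≤1+n _) d≤n)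
                                                              ([eᵢ,eⱼ]≈0 (s≤s z≤n) ≤-refl d≤n)) ⟩
    ad* P [ e b , [ e c , e d ] ]                        ≡⟨ ad*-path-suc (suc i) j _ ⟩
    ad* (path (suc i) j) [ e (suc j) , [ e b , [ e c , e d ] ] ]
      ≈⟨ ad*-zero (path (suc i) j) (Commute-bracket ([eᵢ,eⱼ]≈0 (s≤s z≤n) ≤-refl b≤n)
           (Commute-bracket ([eᵢ,eⱼ]≈0 (s≤s z≤n) (n≤1+n _) c≤n) ([eᵢ,eⱼ]≈0 (s≤s z≤n) (≤-trans (n≤1+n _) (n≤1+n _)) d≤n))) ⟩
    0ᴹ                                                   ∎
    where
    a b c d : ℕ
    a = 2 + j
    b = 3 + j
    c = 4 + j
    d = 5 + j
    c≤n : c ≤ n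
    c≤n = <⇒≤ d≤n
    b≤n : b ≤ n
    b≤n = <⇒≤ c≤n
    P : List ℕ
    P = path (suc i) (suc j)

  N : Carrierᴹ
  N = U 1 2 +ᴹ twice (e 1)

  [e₂,N]≈0 : 2 ≤ n → Commute (e 2) N
  [e₂,N]≈0 2≤n = begin
    [ e 2 , N ]                                       ≈⟨ bracket-+ʳ _ _ _ ⟩
    [ e 2 , U 1 2 ] +ᴹ [ e 2 , twice (e 1) ]          ≈⟨ +ᴹ-cong [e₂u₁₂]≈2[e₁e₂] [e₂,2e₁]≈-2[e₁e₂] ⟩
    twice [ e 1 , e 2 ] -ᴹ twice [ e 1 , e 2 ]        ≈⟨ -ᴹ‿inverseʳ _ ⟩
    0ᴹ                                                ∎
    where
    [e₂,2e₁]≈-2[e₁e₂] : [ e 2 , twice (e 1) ] ≈ᴹ -ᴹ twice [ e 1 , e 2 ]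
    [e₂,2e₁]≈-2[e₁e₂] = ≈ᴹ-trans (bracket-+ʳ _ _ _) (≈ᴹ-trans (twice-cong (bracket-antisym _ _)) (twice-neg _))
    [e₂u₁₂]≈2[e₁e₂] : [ e 2 , U 1 2 ] ≈ᴹ twice [ e 1 , e 2 ]
    [e₂u₁₂]≈2[e₁e₂] = begin
      [ e 2 , [ e 1 , [ e 1 , e 2 ] ] ]                                 ≈⟨ leibniz _ _ _ ⟩
      [ [ e 2 , e 1 ] , [ e 1 , e 2 ] ] +ᴹ [ e 1 , [ e 2 , [ e 1 , e 2 ] ] ]
        ≈⟨ +ᴹ-zeroˡ (≈ᴹ-trans (bracket-congˡ (bracket-antisym _ _)) (≈ᴹ-trans (bracket-negˡ _ _) (-ᴹ-zero (alternating _))))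
                    (bracket-congʳ (Adjacent⇒[b[ab]]≈2b (Adjacent-eᵢ₊₁-eᵢ (s≤s z≤n) 2≤n))) ⟩
      [ e 1 , twice (e 2) ]                                             ≈⟨ bracket-+ʳ _ _ _ ⟩
      twice [ e 1 , e 2 ]                                               ∎

  [eₐ,N]≈0 : ∀ {a} → 4 ≤ a → a ≤ n → Commute (e a) N
  [eₐ,N]≈0 {a} 4≤a a≤n = ≈ᴹ-trans (bracket-+ʳ _ _ _)
    (+ᴹ-zeroˡ (Commute-bracket [eₐe₁]≈0 (Commute-bracket [eₐe₁]≈0 [eₐe₂]≈0))
              (≈ᴹ-trans (bracket-+ʳ _ _ _) (twice-zero [eₐe₁]≈0)))
    where
    [eₐe₁]≈0 : Commute (e a) (e 1)
    [eₐe₁]≈0 = Commute-sym ([eᵢ,eⱼ]≈0 (s≤s z≤n) (≤-trans (s≤s (s≤s (s≤s z≤n))) 4≤a) a≤n)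
    [eₐe₂]≈0 : Commute (e a) (e 2)
    [eₐe₂]≈0 = Commute-sym ([eᵢ,eⱼ]≈0 (s≤s z≤n) 4≤a a≤n)

  [e₃,N]≈-u₁₃ : 3 ≤ n → [ e 3 , N ] ≈ᴹ -ᴹ U 1 3
  [e₃,N]≈-u₁₃ 3≤n = ≈ᴹ-trans (bracket-+ʳ _ _ _)
    (+ᴹ-zeroʳ ([eⱼ₊₁,uᵢⱼ]≈-uᵢⱼ₊₁ (s≤s z≤n) ≤-refl 3≤n)
              (≈ᴹ-trans (bracket-+ʳ _ _ _) (twice-zero (Commute-sym ([eᵢ,eⱼ]≈0 (s≤s z≤n) ≤-refl 3≤n)))))

  u₁₃≈[N,e₃] : 3 ≤ n → U 1 3 ≈ᴹ [ N , e 3 ]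
  u₁₃≈[N,e₃] 3≤n = ≈ᴹ-trans (-ᴹ-flip ([e₃,N]≈-u₁₃ 3≤n)) (≈ᴹ-trans (-ᴹ‿cong (bracket-antisym _ _)) (-ᴹ-involutive _))

  [N,u₁₃]≈0 : 3 ≤ n → Commute N (U 1 3)
  [N,u₁₃]≈0 3≤n = begin
    [ N , U 1 3 ]                                                   ≈⟨ bracket-congʳ (≈ᴹ-trans (u₁₃≈[N,e₃] 3≤n) [N,e₃]≈[u₁₂,e₃]) ⟩
    [ N , [ U 1 2 , e 3 ] ]                                         ≈⟨ bracket-+ˡ _ _ _ ⟩
    [ U 1 2 , [ U 1 2 , e 3 ] ] +ᴹ [ twice (e 1) , [ U 1 2 , e 3 ] ]
      ≈⟨ +ᴹ-zeroˡ ([x₂[x₂z]]≈0 end e₁e₃≈0 (Adjacent-eᵢ-eᵢ₊₁ ≤-refl 3≤n))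
                  (≈ᴹ-trans (bracket-+ˡ _ _ _) (twice-zero (Commute-bracket end e₁e₃≈0))) ⟩
    0ᴹ                                                              ∎
    where
    e₁e₃≈0 : Commute (e 1) (e 3)
    e₁e₃≈0 = [eᵢ,eⱼ]≈0 (s≤s z≤n) ≤-refl 3≤n
    [N,e₃]≈[u₁₂,e₃] : [ N , e 3 ] ≈ᴹ [ U 1 2 , e 3 ]
    [N,e₃]≈[u₁₂,e₃] = ≈ᴹ-trans (bracket-+ˡ _ _ _) (+ᴹ-zeroʳ ≈ᴹ-refl (≈ᴹ-trans (bracket-+ˡ _ _ _) (twice-zero e₁e₃≈0)))

  [eᵢ₊₂,uᵢ₊₁ᵢ₊₂]≈uᵢᵢ₊₂ : ∀ {i} → 1 ≤ i → 2 + i ≤ n → [ e (2 + i) , U (suc i) (2 + i) ] ≈ᴹ U i (2 + i)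
  [eᵢ₊₂,uᵢ₊₁ᵢ₊₂]≈uᵢᵢ₊₂ {suc zero} _ 3≤n =
    [a[bu]]≈u (Adjacent-eᵢ₊₁-eᵢ (s≤s z≤n) 3≤n) ([eⱼ,uᵢⱼ]≈0 (s≤s z≤n) ≤-refl 3≤n) (-ᴹ-flip ([e₃,N]≈-u₁₃ 3≤n))
              (Commute-zeroʳ (Commute-zeroʳ ([e₂,N]≈0 (<⇒≤ 3≤n))))
  [eᵢ₊₂,uᵢ₊₁ᵢ₊₂]≈uᵢᵢ₊₂ {suc (suc i)} _ i+4≤n =
    [a[bu]]≈u (Adjacent-eᵢ₊₁-eᵢ (s≤s z≤n) i+4≤n) ([eⱼ,uᵢⱼ]≈0 (s≤s z≤n) ≤-refl i+4≤n)
              (-ᴹ-flip ([eⱼ₊₁,uᵢⱼ]≈-uᵢⱼ₊₁ (s≤s z≤n) ≤-refl i+4≤n)) (begin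
      [ e (4 + i) , [ e (4 + i) , [ e (3 + i) , U (2 + i) (3 + i) ] ] ]
        ≈⟨ bracket-congʳ (bracket-congʳ ([eᵢ₊₂,uᵢ₊₁ᵢ₊₂]≈uᵢᵢ₊₂ (s≤s z≤n) (<⇒≤ i+4≤n))) ⟩
      [ e (4 + i) , [ e (4 + i) , U (1 + i) (3 + i) ] ]
        ≈⟨ bracket-congʳ ([eⱼ₊₁,uᵢⱼ]≈-uᵢⱼ₊₁ (s≤s z≤n) (n≤1+n _) i+4≤n) ⟩
      [ e (4 + i) , -ᴹ U (1 + i) (4 + i) ]
        ≈⟨ bracket-negʳ _ _ ⟩
      -ᴹ [ e (4 + i) , U (1 + i) (4 + i) ]
        ≈⟨ -ᴹ-zero ([eⱼ,uᵢⱼ]≈0 (s≤s z≤n) (n≤1+n _) i+4≤n) ⟩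
      0ᴹ ∎)

  [eᵢ,uᵢᵢ₊₁]≈0 : ∀ {i} → 2 ≤ i → suc i ≤ n → Commute (e i) (U i (suc i))
  [eᵢ,uᵢᵢ₊₁]≈0 {suc zero}       (s≤s ()) _
  [eᵢ,uᵢᵢ₊₁]≈0 {suc (suc zero)} _ 3≤n = ≈ᴹ-trans (bracket-congʳ (bracket-congʳ (-ᴹ-flip ([e₃,N]≈-u₁₃ 3≤n))))
    ([b[b-x]]≈0 ([b[b[cv]]]≈0 (Adjacent-eᵢ-eᵢ₊₁ ≤-refl 3≤n) ([e₂,N]≈0 (<⇒≤ 3≤n)) [x,0]≈-0 [x,0]≈-0 (bracket-zeroʳ _)))
    where
    [x,0]≈-0 : ∀ {x} → [ x , 0ᴹ ] ≈ᴹ -ᴹ 0ᴹ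
    [x,0]≈-0 = ≈ᴹ-trans (bracket-zeroʳ _) (≈ᴹ-sym (-ᴹ-zero ≈ᴹ-refl))
  [eᵢ,uᵢᵢ₊₁]≈0 {suc (suc (suc i))} _ i+4≤n =
    ≈ᴹ-trans (bracket-congʳ (bracket-congʳ (-ᴹ-flip ([eⱼ₊₁,uᵢⱼ]≈-uᵢⱼ₊₁ (s≤s z≤n) ≤-refl i+4≤n))))
      ([b[b-x]]≈0 ([b[b[cv]]]≈0 (Adjacent-eᵢ-eᵢ₊₁ (s≤s (s≤s z≤n)) i+4≤n)
                               ([eᵢ₊₂,uᵢ₊₁ᵢ₊₂]≈uᵢᵢ₊₂ (s≤s z≤n) (<⇒≤ i+4≤n))
                               ([eⱼ₊₁,uᵢⱼ]≈-uᵢⱼ₊₁ (s≤s z≤n) (n≤1+n _) i+4≤n)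
                               ([eⱼ,uᵢⱼ₊₁]≈-uᵢⱼ (s≤s z≤n) ≤-refl i+4≤n)
                               ([eⱼ,uᵢⱼ]≈0 (s≤s z≤n) ≤-refl (<⇒≤ i+4≤n))))

  [eᵢ,uᵢᵢ₊₂]≈0 : ∀ {i} → 2 ≤ i → 2 + i ≤ n → Commute (e i) (U i (2 + i))
  [eᵢ,uᵢᵢ₊₂]≈0 {i} 2≤i i+2≤n = begin
    [ e i , U i (2 + i) ]                    ≈⟨ bracket-congʳ (-ᴹ-flip ([eⱼ₊₁,uᵢⱼ]≈-uᵢⱼ₊₁ 1≤i ≤-refl i+2≤n)) ⟩
    [ e i , -ᴹ [ e (2 + i) , W ] ]           ≈⟨ bracket-negʳ _ _ ⟩
    -ᴹ [ e i , [ e (2 + i) , W ] ]           ≈⟨ -ᴹ‿cong ([a[yz]]≈[y[az]] W ([eᵢ,eⱼ]≈0 1≤i ≤-refl i+2≤n)) ⟩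
    -ᴹ [ e (2 + i) , [ e i , W ] ]           ≈⟨ -ᴹ-zero (Commute-zeroʳ ([eᵢ,uᵢᵢ₊₁]≈0 2≤i (<⇒≤ i+2≤n))) ⟩
    0ᴹ                                       ∎
    where
    1≤i : 1 ≤ i
    1≤i = <⇒≤ 2≤i
    W : Carrierᴹ
    W = U i (suc i)

  -- The elements of S with second index ≤ k (3 ≤ j excludes exactly u₁₂), together with N.
  data Gen (k : ℕ) : Carrierᴹ → Set μ where
    N∈Gen : Gen k N
    u∈Gen : ∀ {i j} → 1 ≤ i → i < j → j ≤ k → 3 ≤ j → Gen k (U i j)

  Abelian : ℕ → Set (μ ⊔ μ′)
  Abelian k = ∀ {x y} → Gen k x → Gen k y → Commute x y

  Gen-suc : ∀ {k x} → Gen k x → Gen (suc k) x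
  Gen-suc N∈Gen                    = N∈Gen
  Gen-suc (u∈Gen 1≤i i<j j≤k 3≤j) = u∈Gen 1≤i i<j (m≤n⇒m≤1+n j≤k) 3≤j

  data GenSuc (k : ℕ) : Carrierᴹ → Set μ where
    old : ∀ {x} → Gen k x → GenSuc k x
    new : ∀ {i} → 1 ≤ i → i ≤ k → GenSuc k (U i (suc k))

  Gen-suc-view : ∀ {k x} → Gen (suc k) x → GenSuc k x
  Gen-suc-view N∈Gen = old N∈Gen
  Gen-suc-view (u∈Gen 1≤i i<j j≤k+1 3≤j) with ≤-suc-cases j≤k+1
  ... | inj₁ j≤k    = old (u∈Gen 1≤i i<j j≤k 3≤j)
  ... | inj₂ ≡.refl = new 1≤i (m<1+n⇒m≤n i<j)

  [eₐ,Gen]≈0 : ∀ {k a x} → 2 ≤ k → 2 + k ≤ a → a ≤ n → Gen k x → Commute (e a) x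
  [eₐ,Gen]≈0 2≤k k+2≤a a≤n N∈Gen                 = [eₐ,N]≈0 (≤-trans (s≤s (s≤s 2≤k)) k+2≤a) a≤n
  [eₐ,Gen]≈0 2≤k k+2≤a a≤n (u∈Gen 1≤i i<j j≤k _) = [eₐ,uᵢⱼ]≈0 1≤i i<j (≤-trans (s≤s (s≤s j≤k)) k+2≤a) a≤n

  -- For k = 2 the preimage is N: this is where N is needed in place of u₁₂.
  Gen-preimage : ∀ {k i} → 2 ≤ k → 1 ≤ i → i < k → suc k ≤ n →
                 Σ Carrierᴹ λ x → Gen k x × [ e (suc k) , x ] ≈ᴹ -ᴹ U i (suc k)
  Gen-preimage {1} (s≤s ())
  Gen-preimage {2} {1}           _ _ _              3≤n = N , N∈Gen , [e₃,N]≈-u₁₃ 3≤n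
  Gen-preimage {2} {suc (suc i)} _ _ (s≤s (s≤s ()))
  Gen-preimage {suc (suc (suc k))} {i} _ 1≤i i<k k+1≤n =
    U i (3 + k) , u∈Gen 1≤i i<k ≤-refl (s≤s (s≤s (s≤s z≤n))) , [eⱼ₊₁,uᵢⱼ]≈-uᵢⱼ₊₁ 1≤i i<k k+1≤n

  [eₖ₊₁,Gen]-cases : ∀ {k x} → 2 ≤ k → 2 + k ≤ n → Gen k x →
                     Commute (e (suc k)) x ⊎ Σ ℕ λ i → 1 ≤ i × i < k × [ e (suc k) , x ] ≈ᴹ -ᴹ U i (suc k)
  [eₖ₊₁,Gen]-cases {1} (s≤s ())
  [eₖ₊₁,Gen]-cases {2} _ 4≤n N∈Gen = inj₂ (1 , ≤-refl , ≤-refl , [e₃,N]≈-u₁₃ (<⇒≤ 4≤n))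
  [eₖ₊₁,Gen]-cases {suc (suc (suc k))} _ k+5≤n N∈Gen =
    inj₁ ([eₐ,N]≈0 (s≤s (s≤s (s≤s (s≤s z≤n)))) (<⇒≤ k+5≤n))
  [eₖ₊₁,Gen]-cases {suc k} _ k+3≤n (u∈Gen 1≤i i<j j≤k+1 _) with ≤-suc-cases j≤k+1
  ... | inj₁ j≤k    = inj₁ ([eₐ,uᵢⱼ]≈0 1≤i i<j (s≤s (s≤s j≤k)) (<⇒≤ k+3≤n))
  ... | inj₂ ≡.refl = inj₂ (_ , 1≤i , i<j , [eⱼ₊₁,uᵢⱼ]≈-uᵢⱼ₊₁ 1≤i i<j (<⇒≤ k+3≤n))

  abelian≤2 : ∀ {k} → k ≤ 2 → Abelian k
  abelian≤2 k≤2 N∈Gen N∈Gen = alternating N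
  abelian≤2 k≤2 (u∈Gen _ _ j≤k 3≤j) _ = ⊥-elim (n≮n 2 (≤-trans 3≤j (≤-trans j≤k k≤2)))
  abelian≤2 k≤2 N∈Gen (u∈Gen _ _ j≤k 3≤j) = ⊥-elim (n≮n 2 (≤-trans 3≤j (≤-trans j≤k k≤2)))

  module Base (3≤n : 3 ≤ n) where

    [N,u₂₃]≈0 : Commute N (U 2 3)
    [N,u₂₃]≈0 = ≈ᴹ-trans (leibniz _ _ _)
      (+ᴹ-zeroˡ (Commute-zeroˡ (Commute-sym ([e₂,N]≈0 (<⇒≤ 3≤n)))) (Commute-zeroʳ ([N,u₁₃]≈0 3≤n)))

    [u₁₃,u₂₃]≈0 : Commute (U 1 3) (U 2 3)
    [u₁₃,u₂₃]≈0 = begin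
      [ U 1 3 , U 2 3 ]                                   ≈⟨ bracket-congˡ (u₁₃≈[N,e₃] 3≤n) ⟩
      [ [ N , e 3 ] , U 2 3 ]                             ≈⟨ leibniz′ _ _ _ ⟩
      [ N , [ e 3 , U 2 3 ] ] -ᴹ [ e 3 , [ N , U 2 3 ] ]
        ≈⟨ +ᴹ-zeroˡ (≈ᴹ-trans (bracket-congʳ ([eᵢ₊₂,uᵢ₊₁ᵢ₊₂]≈uᵢᵢ₊₂ ≤-refl 3≤n)) ([N,u₁₃]≈0 3≤n))
                    (-ᴹ-zero (Commute-zeroʳ [N,u₂₃]≈0)) ⟩
      0ᴹ                                                  ∎

    data Gen₃ : Carrierᴹ → Set μ where
      N₃  : Gen₃ N
      u₁₃ : Gen₃ (U 1 3)
      u₂₃ : Gen₃ (U 2 3)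

    Gen₃-view : ∀ {x} → Gen 3 x → Gen₃ x
    Gen₃-view g with Gen-suc-view g
    ... | old N∈Gen                    = N₃
    ... | old (u∈Gen _ _ j≤2 3≤j)      = ⊥-elim (n≮n 2 (≤-trans 3≤j j≤2))
    ... | new {1} _ _                  = u₁₃
    ... | new {2} _ _                  = u₂₃
    ... | new {suc (suc (suc i))} _ (s≤s (s≤s ()))

    abelian₃ : Abelian 3
    abelian₃ gx gy = pair (Gen₃-view gx) (Gen₃-view gy)
      where
      pair : ∀ {x y} → Gen₃ x → Gen₃ y → Commute x y
      pair N₃  N₃  = alternating _
      pair N₃  u₁₃ = [N,u₁₃]≈0 3≤n
      pair N₃  u₂₃ = [N,u₂₃]≈0
      pair u₁₃ N₃  = Commute-sym ([N,u₁₃]≈0 3≤n)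
      pair u₁₃ u₁₃ = alternating _
      pair u₁₃ u₂₃ = [u₁₃,u₂₃]≈0
      pair u₂₃ N₃  = Commute-sym [N,u₂₃]≈0
      pair u₂₃ u₁₃ = Commute-sym [u₁₃,u₂₃]≈0
      pair u₂₃ u₂₃ = alternating _

  -- Passing from index 3 + q to 4 + q.  In the names below an unprimed uᵢ is u_{i,3+q} and a primed
  -- uᵢ′ is u_{i,4+q}.
  module Step (q : ℕ) (q+4≤n : 4 + q ≤ n) (IH : Abelian (3 + q)) where

    q+3≤n : 3 + q ≤ n
    q+3≤n = <⇒≤ q+4≤n

    uᵢ∈Gen : ∀ {i} → 1 ≤ i → i ≤ 2 + q → Gen (3 + q) (U i (3 + q))
    uᵢ∈Gen 1≤i i≤q+2 = u∈Gen 1≤i (s≤s i≤q+2) ≤-refl (s≤s (s≤s (s≤s z≤n)))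

    [uᵢ,e₄₊q]≈uᵢ′ : ∀ {i} → 1 ≤ i → i ≤ 2 + q → [ U i (3 + q) , e (4 + q) ] ≈ᴹ U i (4 + q)
    [uᵢ,e₄₊q]≈uᵢ′ 1≤i i≤q+2 = [uᵢⱼ,eⱼ₊₁]≈uᵢⱼ₊₁ 1≤i (s≤s i≤q+2) q+4≤n

    [x,uₖ′]≈0 : ∀ {x k} → Gen (2 + q) x → 1 ≤ k → k ≤ 2 + q → Commute x (U k (4 + q))
    [x,uₖ′]≈0 gx 1≤k k≤q+2 = Commute-respʳ (≈ᴹ-sym ([uᵢ,e₄₊q]≈uᵢ′ 1≤k k≤q+2))
      (Commute-bracket (IH (Gen-suc gx) (uᵢ∈Gen 1≤k k≤q+2))
                       (Commute-sym ([eₐ,Gen]≈0 (s≤s (s≤s z≤n)) ≤-refl q+4≤n gx)))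

    [uᵢ,uₖ′]≈[uₖ,uᵢ′] : ∀ {i k} → 1 ≤ i → i ≤ 2 + q → 1 ≤ k → k ≤ 2 + q →
                        [ U i (3 + q) , U k (4 + q) ] ≈ᴹ [ U k (3 + q) , U i (4 + q) ]
    [uᵢ,uₖ′]≈[uₖ,uᵢ′] {i} {k} 1≤i i≤q+2 1≤k k≤q+2 = begin
      [ U i (3 + q) , U k (4 + q) ]                    ≈⟨ bracket-congʳ ([uᵢ,e₄₊q]≈uᵢ′ 1≤k k≤q+2) ⟨
      [ U i (3 + q) , [ U k (3 + q) , e (4 + q) ] ]    ≈⟨ [a[yz]]≈[y[az]] _ (IH (uᵢ∈Gen 1≤i i≤q+2) (uᵢ∈Gen 1≤k k≤q+2)) ⟩
      [ U k (3 + q) , [ U i (3 + q) , e (4 + q) ] ]    ≈⟨ bracket-congʳ ([uᵢ,e₄₊q]≈uᵢ′ 1≤i i≤q+2) ⟩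
      [ U k (3 + q) , U i (4 + q) ]                    ∎

    [uᵢ,uₖ′]≈0-low : ∀ {i k} → 1 ≤ i → i ≤ 1 + q → 1 ≤ k → k ≤ 1 + q → Commute (U i (3 + q)) (U k (4 + q))
    [uᵢ,uₖ′]≈0-low {i} {k} 1≤i i≤q+1 1≤k k≤q+1 with Gen-preimage (s≤s (s≤s z≤n)) 1≤i (s≤s i≤q+1) q+3≤n
    ... | x , gx , [e₃₊q,x]≈-uᵢ = begin
      [ U i (3 + q) , U k (4 + q) ]                            ≈⟨ bracket-congˡ (-ᴹ-flip [e₃₊q,x]≈-uᵢ) ⟩
      [ -ᴹ [ e (3 + q) , x ] , U k (4 + q) ]                   ≈⟨ bracket-negˡ _ _ ⟩
      -ᴹ [ [ e (3 + q) , x ] , U k (4 + q) ]                   ≈⟨ -ᴹ‿cong (leibniz′ _ _ _) ⟩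
      -ᴹ ([ e (3 + q) , [ x , U k (4 + q) ] ] -ᴹ [ x , [ e (3 + q) , U k (4 + q) ] ])
        ≈⟨ -ᴹ-zero (+ᴹ-zeroˡ (Commute-zeroʳ ([x,uₖ′]≈0 gx 1≤k (m≤n⇒m≤1+n k≤q+1))) (-ᴹ-zero [x,[e₃₊q,uₖ′]]≈0)) ⟩
      0ᴹ                                                       ∎
      where
      [x,[e₃₊q,uₖ′]]≈0 : [ x , [ e (3 + q) , U k (4 + q) ] ] ≈ᴹ 0ᴹ
      [x,[e₃₊q,uₖ′]]≈0 = ≈ᴹ-trans (bracket-congʳ ([eⱼ,uᵢⱼ₊₁]≈-uᵢⱼ 1≤k (s≤s (s≤s k≤q+1)) q+4≤n))
        (≈ᴹ-trans (bracket-negʳ _ _) (-ᴹ-zero (IH (Gen-suc gx) (uᵢ∈Gen 1≤k (m≤n⇒m≤1+n k≤q+1)))))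

    [u₂₊q,u₁₊q′]≈-[u₁₊q,u₂₊q′] : [ U (2 + q) (3 + q) , U (1 + q) (4 + q) ] ≈ᴹ -ᴹ [ U (1 + q) (3 + q) , U (2 + q) (4 + q) ]
    [u₂₊q,u₁₊q′]≈-[u₁₊q,u₂₊q′] = ≈ᴹ-trans (leibniz′ _ _ _)
      (+ᴹ-zeroˡ (Commute-zeroʳ ([uᵢ,uₖ′]≈0-low (s≤s z≤n) ≤-refl (s≤s z≤n) ≤-refl)) ≈ᴹ-refl)

    [u₁₊q,u₂₊q′]≈0 : Commute (U (1 + q) (3 + q)) (U (2 + q) (4 + q))
    [u₁₊q,u₂₊q′]≈0 = x≈-x⇒x≈0 (≈ᴹ-trans ([uᵢ,uₖ′]≈[uₖ,uᵢ′] (s≤s z≤n) (n≤1+n _) (s≤s z≤n) ≤-refl)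
                                        [u₂₊q,u₁₊q′]≈-[u₁₊q,u₂₊q′])

    [u₂₊q,uₖ′]≈0 : ∀ {k} → 1 ≤ k → k ≤ 2 + q → Commute (U (2 + q) (3 + q)) (U k (4 + q))
    [u₂₊q,uₖ′]≈0 {k} 1≤k k≤q+2 with ≤-suc-cases k≤q+2
    ... | inj₂ ≡.refl = ≈ᴹ-trans (leibniz′ _ _ _)
      (+ᴹ-zeroˡ (Commute-zeroʳ [u₁₊q,u₂₊q′]≈0) (-ᴹ-zero (Commute-zeroʳ ([eᵢ,uᵢᵢ₊₂]≈0 (s≤s (s≤s z≤n)) q+4≤n))))
    ... | inj₁ k≤q+1 with ≤-suc-cases k≤q+1
    ...   | inj₂ ≡.refl = ≈ᴹ-trans [u₂₊q,u₁₊q′]≈-[u₁₊q,u₂₊q′] (-ᴹ-zero [u₁₊q,u₂₊q′]≈0)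
    ...   | inj₁ k≤q = ≈ᴹ-trans (leibniz′ _ _ _)
      (+ᴹ-zeroˡ (Commute-zeroʳ ([uᵢ,uₖ′]≈0-low (s≤s z≤n) ≤-refl 1≤k k≤q+1))
                (-ᴹ-zero (Commute-zeroʳ ([eⱼ,uᵢⱼ₊₂]≈0 1≤k (s≤s (s≤s k≤q)) q+4≤n))))

    [uᵢ,uₖ′]≈0 : ∀ {i k} → 1 ≤ i → i ≤ 2 + q → 1 ≤ k → k ≤ 2 + q → Commute (U i (3 + q)) (U k (4 + q))
    [uᵢ,uₖ′]≈0 1≤i i≤q+2 1≤k k≤q+2 with ≤-suc-cases i≤q+2 | ≤-suc-cases k≤q+2
    ... | inj₂ ≡.refl | _           = [u₂₊q,uₖ′]≈0 1≤k k≤q+2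
    ... | inj₁ i≤q+1  | inj₂ ≡.refl = ≈ᴹ-trans ([uᵢ,uₖ′]≈[uₖ,uᵢ′] 1≤i i≤q+2 1≤k k≤q+2) ([u₂₊q,uₖ′]≈0 1≤i i≤q+2)
    ... | inj₁ i≤q+1  | inj₁ k≤q+1  = [uᵢ,uₖ′]≈0-low 1≤i i≤q+1 1≤k k≤q+1

    [x,u₃₊q′]≈0 : ∀ {x} → Gen (2 + q) x → Commute x (U (3 + q) (4 + q))
    [x,u₃₊q′]≈0 {x} gx = ≈ᴹ-trans (leibniz _ _ _)
      (+ᴹ-zeroʳ [[x,e₃₊q],u₂₊q′]≈0 (Commute-zeroʳ ([x,uₖ′]≈0 gx (s≤s z≤n) ≤-refl)))
      where
      [[x,e₃₊q],u₂₊q′]≈0 : [ [ x , e (3 + q) ] , U (2 + q) (4 + q) ] ≈ᴹ 0ᴹ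
      [[x,e₃₊q],u₂₊q′]≈0 with [eₖ₊₁,Gen]-cases (s≤s (s≤s z≤n)) q+4≤n gx
      ... | inj₁ [e₃₊q,x]≈0                  = Commute-zeroˡ (Commute-sym [e₃₊q,x]≈0)
      ... | inj₂ (i , 1≤i , i<q+2 , [e₃₊q,x]≈-uᵢ) =
        Commute-respˡ (≈ᴹ-trans (bracket-antisym _ _) (≈ᴹ-trans (-ᴹ‿cong [e₃₊q,x]≈-uᵢ) (-ᴹ-involutive _)))
                      ([uᵢ,uₖ′]≈0 1≤i (<⇒≤ i<q+2) (s≤s z≤n) ≤-refl)

    [uᵢ,u₃₊q′]≈0 : ∀ {i} → 1 ≤ i → i ≤ 2 + q → Commute (U i (3 + q)) (U (3 + q) (4 + q))
    [uᵢ,u₃₊q′]≈0 {i} 1≤i i≤q+2 = ≈ᴹ-trans (leibniz _ _ _)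
      (+ᴹ-zeroʳ [[uᵢ,e₃₊q],u₂₊q′]≈0 (Commute-zeroʳ ([uᵢ,uₖ′]≈0 1≤i i≤q+2 (s≤s z≤n) ≤-refl)))
      where
      [[uᵢ,e₃₊q],u₂₊q′]≈0 : [ [ U i (3 + q) , e (3 + q) ] , U (2 + q) (4 + q) ] ≈ᴹ 0ᴹ
      [[uᵢ,e₃₊q],u₂₊q′]≈0 with ≤-suc-cases i≤q+2
      ... | inj₁ i≤q+1  = Commute-zeroˡ (Commute-sym ([eⱼ,uᵢⱼ]≈0 1≤i (s≤s (s≤s i≤q+1)) q+3≤n))
      ... | inj₂ ≡.refl = Commute-respˡ
        (≈ᴹ-trans (bracket-antisym _ _) (-ᴹ‿cong ([eᵢ₊₂,uᵢ₊₁ᵢ₊₂]≈uᵢᵢ₊₂ (s≤s z≤n) q+3≤n)))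
        (≈ᴹ-trans (bracket-negˡ _ _) (-ᴹ-zero [u₁₊q,u₂₊q′]≈0))

    [Gen,uₖ′]≈0 : ∀ {x k} → Gen (3 + q) x → 1 ≤ k → k ≤ 3 + q → Commute x (U k (4 + q))
    [Gen,uₖ′]≈0 gx 1≤k k≤q+3 with Gen-suc-view gx | ≤-suc-cases k≤q+3
    ... | old gx′         | inj₁ k≤q+2  = [x,uₖ′]≈0 gx′ 1≤k k≤q+2
    ... | old gx′         | inj₂ ≡.refl = [x,u₃₊q′]≈0 gx′
    ... | new 1≤i i≤q+2   | inj₁ k≤q+2  = [uᵢ,uₖ′]≈0 1≤i i≤q+2 1≤k k≤q+2
    ... | new 1≤i i≤q+2   | inj₂ ≡.refl = [uᵢ,u₃₊q′]≈0 1≤i i≤q+2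

    [uᵢ′,uₖ′]≈0-low : ∀ {i k} → 1 ≤ i → i ≤ 2 + q → 1 ≤ k → k ≤ 3 + q → Commute (U i (4 + q)) (U k (4 + q))
    [uᵢ′,uₖ′]≈0-low {i} {k} 1≤i i≤q+2 1≤k k≤q+3 = begin
      [ U i (4 + q) , U k (4 + q) ]                  ≈⟨ bracket-congˡ ([uᵢ,e₄₊q]≈uᵢ′ 1≤i i≤q+2) ⟨
      [ [ U i (3 + q) , e (4 + q) ] , U k (4 + q) ]  ≈⟨ leibniz′ _ _ _ ⟩
      [ U i (3 + q) , [ e (4 + q) , U k (4 + q) ] ] -ᴹ [ e (4 + q) , [ U i (3 + q) , U k (4 + q) ] ]
        ≈⟨ +ᴹ-zeroˡ [uᵢ,[e₄₊q,uₖ′]]≈0 (-ᴹ-zero (Commute-zeroʳ ([Gen,uₖ′]≈0 (uᵢ∈Gen 1≤i i≤q+2) 1≤k k≤q+3))) ⟩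
      0ᴹ                                              ∎
      where
      [uᵢ,[e₄₊q,uₖ′]]≈0 : [ U i (3 + q) , [ e (4 + q) , U k (4 + q) ] ] ≈ᴹ 0ᴹ
      [uᵢ,[e₄₊q,uₖ′]]≈0 with ≤-suc-cases k≤q+3
      ... | inj₁ k≤q+2  = Commute-zeroʳ ([eⱼ,uᵢⱼ]≈0 1≤k (s≤s (s≤s k≤q+2)) q+4≤n)
      ... | inj₂ ≡.refl = Commute-respʳ ([eᵢ₊₂,uᵢ₊₁ᵢ₊₂]≈uᵢᵢ₊₂ (s≤s z≤n) q+4≤n) ([uᵢ,uₖ′]≈0 1≤i i≤q+2 (s≤s z≤n) ≤-refl)

    [uᵢ′,uₖ′]≈0 : ∀ {i k} → 1 ≤ i → i ≤ 3 + q → 1 ≤ k → k ≤ 3 + q → Commute (U i (4 + q)) (U k (4 + q))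
    [uᵢ′,uₖ′]≈0 1≤i i≤q+3 1≤k k≤q+3 with ≤-suc-cases i≤q+3 | ≤-suc-cases k≤q+3
    ... | inj₁ i≤q+2  | _           = [uᵢ′,uₖ′]≈0-low 1≤i i≤q+2 1≤k k≤q+3
    ... | inj₂ ≡.refl | inj₁ k≤q+2  = Commute-sym ([uᵢ′,uₖ′]≈0-low 1≤k k≤q+2 1≤i i≤q+3)
    ... | inj₂ ≡.refl | inj₂ ≡.refl = alternating _

    abelian-step : Abelian (4 + q)
    abelian-step gx gy with Gen-suc-view gx | Gen-suc-view gy
    ... | old gx′       | old gy′       = IH gx′ gy′
    ... | old gx′       | new 1≤k k≤q+3 = [Gen,uₖ′]≈0 gx′ 1≤k k≤q+3
    ... | new 1≤i i≤q+3 | old gy′       = Commute-sym ([Gen,uₖ′]≈0 gy′ 1≤i i≤q+3)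
    ... | new 1≤i i≤q+3 | new 1≤k k≤q+3 = [uᵢ′,uₖ′]≈0 1≤i i≤q+3 1≤k k≤q+3

  abelian : ∀ k → k ≤ n → Abelian k
  abelian 0                             _     = abelian≤2 z≤n
  abelian 1                             _     = abelian≤2 (s≤s z≤n)
  abelian 2                             _     = abelian≤2 ≤-refl
  abelian 3                             3≤n   = Base.abelian₃ 3≤n
  abelian (suc (suc (suc (suc q))))     q+4≤n = Step.abelian-step q q+4≤n (abelian (suc (suc (suc q))) (<⇒≤ q+4≤n))

  S-commute : ∀ {x y} → InS L n e x → InS L n e y → Commute x y
  S-commute (i , j , 1≤i , i<j , j≤n , ≢u₁₂ , lift x≈uᵢⱼ) (k , l , 1≤k , k<l , l≤n , ≢u₁₂′ , lift y≈uₖₗ) =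
    Commute-respˡ x≈uᵢⱼ (Commute-respʳ y≈uₖₗ (abelian n ≤-refl
      (u∈Gen 1≤i i<j j≤n (¬[i≡1×j≡2]⇒3≤j 1≤i i<j ≢u₁₂))
      (u∈Gen 1≤k k<l l≤n (¬[i≡1×j≡2]⇒3≤j 1≤k k<l ≢u₁₂′))))

lemma2p10 : ∀ {c ℓ m ℓm : Level} (K : CommutativeRing c ℓ) → IsCharZeroField K →
    (L : LieAlgebra K m ℓm) →
    (n : ℕ) → 2 ≤ n → (e : ℕ → LieAlgebra.Carrierᴹ L) →
    ElectricalCRelations L n e →
    ∀ x y → Span L (InS L n e) x → Span L (InS L n e) y →
    LieAlgebra._≈ᴹ_ L (LieAlgebra.[_,_] L x y) (LieAlgebra.0ᴹ L)
lemma2p10 K charZeroK L n _ e R x y = LieAlgebraProperties.Span-abelian L (Electrical.S-commute charZeroK L R)
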